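{- Set $N=\lfloor n^{7/12}\rfloor$. Let $P$ be the permutation matrix of a uniformly random permutation in $S_n$, let $P_{[N]\times[N]}$ be its top-left $N\times N$ submatrix, and let $Q$ be a random $N\times N$ matrix with i.i.d. $\mathrm{Bernoulli}(1/n)$ entries. Let $\mathcal{M}_n$ be the set of $N\times N$ matrices $M$ with entries in $\{0,1\}$ such that $\sum_{i,j}M(i,j)\le n^{1/5}$ and each row and each column of $M$ contains at most one $1$. Then $$\sup_{M\in\mathcal{M}_n}\left|\frac{\mathbb{P}(P_{[N]\times[N]}=M)}{\mathbb{P}(Q=M)}-1\right|\to 0 \quad\text{as } n\to\infty.$$
   Context: For $\sigma\in S_n$, its permutation matrix has $P(i,j)=1$ iff $\sigma(i)=j$. -}

module Defs where

open import Data.Nat as ℕ using (ℕ; zero; suc; _^_; _≤ᵇ_)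
open import Data.Integer as ℤ using (+_; +[1+_]; -[1+_])
open import Data.Rational as ℚ using (ℚ; mkℚ; 0ℚ; 1ℚ; _÷_)
open import Data.Bool using (Bool; true; false; if_then_else_; _∧_)
open import Data.Fin as Fin using (Fin; toℕ)
open import Data.Vec as Vec using (Vec; []; _∷_)
open import Data.List as List using (List; []; _∷_; concatMap; map; filter; length; allFin)
open import Data.Bool.ListAction using (and)
open import Data.Nat.ListAction using (sum)
open import Relation.Binary.PropositionalEquality using (_≡_)

-- N = ⌊ n^(7/12) ⌋ : the largest N ≤ n with N^12 ≤ n^7
largestUpTo : (ℕ → Bool) → ℕ → ℕ
largestUpTo P zero = zero
largestUpTo P (suc k) = if P (suc k) then suc k else largestUpTo P k

floorN : ℕ → ℕ
floorN n = largestUpTo (λ m → (m ^ 12) ≤ᵇ (n ^ 7)) n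

allVecs : (n k : ℕ) → List (Vec (Fin n) k)
allVecs n zero = [] ∷ []
allVecs n (suc k) = concatMap (λ x → map (x ∷_) (allVecs n k)) (allFin n)

-- S_n : σ represented by the vector (σ(0),…,σ(n-1)); all injective ones
Sn : (n : ℕ) → List (Vec (Fin n) n)
Sn n = filter (λ v → unique? (Vec.toList v)) (allVecs n n)
  where open import Data.List.Relation.Unary.Unique.DecPropositional (Fin._≟_ {n}) using (unique?)

lookupℕ : ∀ {A : Set} {k} → Vec A k → ℕ → A → A
lookupℕ [] i d = d
lookupℕ (x ∷ v) zero d = x
lookupℕ (x ∷ v) (suc i) d = lookupℕ v i d

permEntry : ∀ {n} → Vec (Fin n) n → ℕ → ℕ → Bool
permEntry {zero} σ i j = false
permEntry {suc n} σ i j = toℕ (lookupℕ σ i Fin.zero) ℕ.≡ᵇ j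
  where open import Data.Nat using (_≡ᵇ_)

Mat : ℕ → Set
Mat N = Fin N → Fin N → Bool

boolEq : Bool → Bool → Bool
boolEq true b = b
boolEq false true = false
boolEq false false = true

topLeftIs : ∀ {n N} → Vec (Fin n) n → Mat N → Bool
topLeftIs {N = N} σ M =
  and (concatMap (λ i → map (λ j → boolEq (permEntry σ (toℕ i) (toℕ j)) (M i j)) (allFin N)) (allFin N))

-- rational a / d (d = 0 never occurs in use; junk value 0)
divℕ : ℕ → ℕ → ℚ
divℕ a zero = 0ℚ
divℕ a (suc d) = (+ a) ℚ./ suc d

probPerm : (n N : ℕ) → Mat N → ℚ
probPerm n N M = divℕ (length (filter (λ σ → topLeftIs σ M Data.Bool.≟ true) (Sn n))) (length (Sn n))
  where import Data.Bool

probBern : (p : ℚ) (N : ℕ) → Mat N → ℚ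
probBern p N M =
  List.foldr ℚ._*_ 1ℚ
    (concatMap (λ i → map (λ j → if M i j then p else (1ℚ ℚ.- p)) (allFin N)) (allFin N))

ones : ∀ {N} → Mat N → ℕ
ones {N} M = sum (concatMap (λ i → map (λ j → if M i j then 1 else 0) (allFin N)) (allFin N))

record InM (n : ℕ) (M : Mat (floorN n)) : Set where
  field
    sumBound : ones M ^ 5 ℕ.≤ n            -- Σ M(i,j) ≤ n^(1/5)
    rowAtMostOne : ∀ i j j' → M i j ≡ true → M i j' ≡ true → j ≡ j'
    colAtMostOne : ∀ i i' j → M i j ≡ true → M i' j ≡ true → i ≡ i'

-- ratio p / q (junk value 0 when q = 0)
ratio : ℚ → ℚ → ℚ
ratio p q@(mkℚ +[1+ _ ] _ _) = p ÷ q
ratio p q@(mkℚ -[1+ _ ] _ _) = p ÷ q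
ratio p (mkℚ (+ zero) _ _) = 0ℚ

module Submission where

-- Let m be the number of empty rows of M, k = N - m its number of ones and b = n - 1. A permutation
-- has top-left block M iff every filled row goes to the column of its 1 and every empty row to one
-- of the n - N columns ≥ N, so P(P_[N]×[N] = M) = (n-N)↓m (n-N)! / n! (x↓m the falling factorial),
-- while P(Q = M) = b^(N²-k) / n^(N²). Writing n! = n↓m (n-m)↓k (n-N)!, the ratio is A₁ A₂ with
--   A₁ = ∏ over the empty rows i of (n-N-i) n^N / ((n-i) b^N),
--   A₂ = ∏ over the filled rows i of n^N / ((n-m-i) b^(N-1)).
-- Bernoulli-type inequalities give 1 - O(N³/n²) ≤ A₁ ≤ 1 ≤ A₂ ≤ 1 + O(kN/n), and N ≤ n^(7/12),
-- k ≤ n^(1/5) make both error terms o(1). All estimates are cross-multiplied so that they live in ℕ.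

open import Defs

module _ where

  open import Data.Nat
  open import Data.Nat.Properties
  open import Data.Nat.Tactic.RingSolver using (solve-∀)
  open import Data.Nat.ListAction using (sum)
  open import Data.Nat.ListAction.Properties using (sum-++)
  open import Algebra.Properties.CommutativeSemigroup *-commutativeSemigroup using (interchange; x∙yz≈y∙xz; x∙yz≈yx∙z; xy∙z≈y∙xz; xy∙z≈xz∙y)
  open import Data.Bool as Bool using (Bool; true; false; _∧_; _∨_; not; if_then_else_; T)
  import Data.Bool.Properties as Bool
  open import Data.Bool.ListAction using (and)
  open import Data.Bool.Solver using (module ∨-∧-Solver)
  open import Data.Fin as Fin using (Fin; toℕ; fromℕ<)
  import Data.Fin.Properties as Fin
  open import Data.Vec as Vec using (Vec; []; _∷_)
  open import Data.List as List using (List; []; _∷_; _++_; concat; concatMap; map; tabulate; length; filter; allFin)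
  import Data.List.Properties as List
  import Data.List.Relation.Unary.All as All
  open import Data.Product using (Σ; _,_; _×_)
  open import Data.Sum using (_⊎_; inj₁; inj₂)
  open import Function using (_∘_; _$_; id)
  open import Relation.Binary.PropositionalEquality
  open import Relation.Nullary using (yes; no; does; ¬?; contradiction)
  open import Relation.Nullary.Decidable using (dec-true; dec-false)
  open import Relation.Unary using (Decidable)

  infixr 8 _↓_

  _↓_ : ℕ → ℕ → ℕ
  x ↓ zero  = 1
  x ↓ suc m = x * (x ∸ 1) ↓ m

  ↓-split : ∀ x a c → x ↓ (a + c) ≡ x ↓ a * (x ∸ a) ↓ c
  ↓-split x zero    c = sym (+-identityʳ (x ↓ c))
  ↓-split x (suc a) c = begin
    x * (x ∸ 1) ↓ (a + c)                   ≡⟨ cong (x *_) (↓-split (x ∸ 1) a c) ⟩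
    x * ((x ∸ 1) ↓ a * (x ∸ 1 ∸ a) ↓ c)     ≡⟨ cong (λ t → x * ((x ∸ 1) ↓ a * t ↓ c)) (∸-+-assoc x 1 a) ⟩
    x * ((x ∸ 1) ↓ a * (x ∸ suc a) ↓ c)     ≡⟨ *-assoc x _ _ ⟨
    x * (x ∸ 1) ↓ a * (x ∸ suc a) ↓ c       ∎
    where open ≡-Reasoning

  ↓-lower : ∀ x k → (x ∸ k) ^ k ≤ x ↓ k
  ↓-lower x zero    = ≤-refl
  ↓-lower x (suc k) = *-mono-≤ (m∸n≤m x (suc k))
    (subst (λ t → t ^ k ≤ (x ∸ 1) ↓ k) (∸-+-assoc x 1 k) (↓-lower (x ∸ 1) k))

  ↓-upper : ∀ x k → x ↓ k ≤ x ^ k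
  ↓-upper x zero    = ≤-refl
  ↓-upper x (suc k) = *-monoʳ-≤ x (≤-trans (↓-upper (x ∸ 1) k) (^-monoˡ-≤ k (m∸n≤m x 1)))

  ↓-positive : ∀ x k → k ≤ x → 0 < x ↓ k
  ↓-positive x       zero    _         = z<s
  ↓-positive (suc x) (suc k) (s≤s k≤x) = *-mono-≤ {1} {suc x} z<s (↓-positive x k k≤x)

  -- s^k - w^k ≤ k (s - w) s^(k-1) for s = z + w, multiplied by s.
  ^-gap : ∀ z w k → (z + w) ^ suc k ≤ w ^ k * (z + w) + k * z * (z + w) ^ k
  ^-gap z w zero    = ≤-reflexive (base z w)
    where
    base : ∀ z w → (z + w) * 1 ≡ 1 * (z + w) + 0 * z * 1
    base = solve-∀
  ^-gap z w (suc k) = begin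
    (z + w) * ((z + w) * s)                             ≡⟨ expand z w s ⟩
    z * ((z + w) * s) + w * ((z + w) * s)               ≤⟨ +-monoʳ-≤ (z * ((z + w) * s)) (*-monoʳ-≤ w (^-gap z w k)) ⟩
    z * ((z + w) * s) + w * (t * (z + w) + k * z * s)   ≡⟨ regroup z w s t k ⟩
    (z * ((z + w) * s) + w * t * (z + w)) + w * (k * z * s)
      ≤⟨ +-monoʳ-≤ (z * ((z + w) * s) + w * t * (z + w)) (*-monoˡ-≤ (k * z * s) (m≤n+m w z)) ⟩
    (z * ((z + w) * s) + w * t * (z + w)) + (z + w) * (k * z * s) ≡⟨ collect z w s t k ⟩
    w * t * (z + w) + suc k * z * ((z + w) * s)         ∎
    where
    open ≤-Reasoning
    s = (z + w) ^ k
    t = w ^ k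
    expand : ∀ z w s → (z + w) * ((z + w) * s) ≡ z * ((z + w) * s) + w * ((z + w) * s)
    expand = solve-∀
    regroup : ∀ z w s t k → z * ((z + w) * s) + w * (t * (z + w) + k * z * s)
                          ≡ (z * ((z + w) * s) + w * t * (z + w)) + w * (k * z * s)
    regroup = solve-∀
    collect : ∀ z w s t k → (z * ((z + w) * s) + w * t * (z + w)) + (z + w) * (k * z * s)
                          ≡ w * t * (z + w) + suc k * z * ((z + w) * s)
    collect = solve-∀

  -- With s = z + w this is Bernoulli's inequality (1 - z/s)^k ≥ 1 - k z/s.
  bernoulli : ∀ z w k → (z + w) ^ k * (z + w ∸ k * z) ≤ (z + w) * w ^ k
  bernoulli z w k with k * z ≤? z + w
  ... | no kz≰s = ≤-trans (≤-reflexive (trans (cong ((z + w) ^ k *_) (m≤n⇒m∸n≡0 (<⇒≤ (≰⇒> kz≰s))))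
                                              (*-zeroʳ ((z + w) ^ k)))) z≤n
  ... | yes kz≤s = +-cancelʳ-≤ (k * z * (z + w) ^ k) _ _ (begin
    (z + w) ^ k * (z + w ∸ k * z) + k * z * (z + w) ^ k  ≡⟨ factor ((z + w) ^ k) (z + w ∸ k * z) (k * z) ⟩
    (z + w) ^ k * (z + w ∸ k * z + k * z)                ≡⟨ cong ((z + w) ^ k *_) (m∸n+n≡m kz≤s) ⟩
    (z + w) ^ k * (z + w)                                ≡⟨ *-comm ((z + w) ^ k) (z + w) ⟩
    (z + w) ^ suc k                                      ≤⟨ ^-gap z w k ⟩
    w ^ k * (z + w) + k * z * (z + w) ^ k                ≡⟨ cong (_+ k * z * (z + w) ^ k) (*-comm (w ^ k) (z + w)) ⟩
    (z + w) * w ^ k + k * z * (z + w) ^ k                ∎)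
    where
    open ≤-Reasoning
    factor : ∀ p a c → p * a + c * p ≡ p * (a + c)
    factor = solve-∀

  bernoulli-inverse : ∀ b N → b ^ N * (suc b + N) ≤ suc b ^ suc N
  bernoulli-inverse b zero    = ≤-reflexive (base b)
    where
    base : ∀ b → 1 * (suc b + 0) ≡ suc b * 1
    base = solve-∀
  bernoulli-inverse b (suc N) = begin
    b * b ^ N * (suc b + suc N)    ≡⟨ xy∙z≈y∙xz b (b ^ N) (suc b + suc N) ⟩
    b ^ N * (b * (suc b + suc N))  ≤⟨ *-monoʳ-≤ (b ^ N) (≤-trans (m≤m+n _ (suc N)) (≤-reflexive (sym (expand b N)))) ⟩
    b ^ N * (suc b * (suc b + N))  ≡⟨ x∙yz≈y∙xz (b ^ N) (suc b) (suc b + N) ⟩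
    suc b * (b ^ N * (suc b + N))  ≤⟨ *-monoʳ-≤ (suc b) (bernoulli-inverse b N) ⟩
    suc b * suc b ^ suc N          ∎
    where
    open ≤-Reasoning
    expand : ∀ b N → suc b * (suc b + N) ≡ b * (suc b + suc N) + suc N
    expand = solve-∀

  suc-*-pred≤ : ∀ D t → t ≤ D → suc D * pred t ≤ D * t
  suc-*-pred≤ D zero     _   = ≤-trans (≤-reflexive (*-zeroʳ (suc D))) z≤n
  suc-*-pred≤ D (suc t) t<D = subst (suc D * t ≤_) (sym (*-suc D t)) (+-monoˡ-≤ (D * t) (<⇒≤ t<D))

  bernoulli-reciprocal : ∀ D m → suc D ^ m * (D ∸ m) ≤ D ^ suc m
  bernoulli-reciprocal D zero    = ≤-reflexive (trans (+-identityʳ D) (sym (*-identityʳ D)))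
  bernoulli-reciprocal D (suc m) = begin
    suc D * p * (D ∸ suc m)      ≡⟨ cong (λ t → suc D * p * t) (pred[m∸n]≡m∸[1+n] D m) ⟨
    suc D * p * pred (D ∸ m)     ≡⟨ xy∙z≈y∙xz (suc D) p (pred (D ∸ m)) ⟩
    p * (suc D * pred (D ∸ m))   ≤⟨ *-monoʳ-≤ p (suc-*-pred≤ D (D ∸ m) (m∸n≤m D m)) ⟩
    p * (D * (D ∸ m))            ≡⟨ x∙yz≈y∙xz p D (D ∸ m) ⟩
    D * (p * (D ∸ m))            ≤⟨ *-monoʳ-≤ D (bernoulli-reciprocal D m) ⟩
    D * D ^ suc m                ∎
    where
    open ≤-Reasoning
    p = suc D ^ m

  shift-step-upper : ∀ c N n X Y → c + N ≤ n → n * X ≤ Y * n + N * X → c * X * n ≤ (c + N) * Y * n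
  shift-step-upper c N n X Y c+N≤n h = +-cancelʳ-≤ (N * ((c + N) * X)) _ _ (begin
    c * X * n + N * ((c + N) * X)        ≤⟨ +-monoʳ-≤ (c * X * n) (*-monoʳ-≤ N (*-monoˡ-≤ X c+N≤n)) ⟩
    c * X * n + N * (n * X)              ≡⟨ distrib c N n X ⟩
    (c + N) * (n * X)                    ≤⟨ *-monoʳ-≤ (c + N) h ⟩
    (c + N) * (Y * n + N * X)            ≡⟨ regroup c N n X Y ⟩
    (c + N) * Y * n + N * ((c + N) * X)  ∎)
    where
    open ≤-Reasoning
    distrib : ∀ c N n X → c * X * n + N * (n * X) ≡ (c + N) * (n * X)
    distrib = solve-∀
    regroup : ∀ c N n X Y → (c + N) * (Y * n + N * X) ≡ (c + N) * Y * n + N * ((c + N) * X)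
    regroup = solve-∀

  shift-factor-upper : ∀ b c N → c + N ≤ suc b → c * suc b ^ N ≤ (c + N) * b ^ N
  shift-factor-upper b c N c+N≤n = *-cancelʳ-≤ _ _ (suc b)
    (shift-step-upper c N (suc b) (suc b ^ N) (b ^ N) c+N≤n
      (subst (λ t → suc b ^ suc N ≤ b ^ N * suc b + t * suc b ^ N) (*-identityʳ N) (^-gap 1 b N)))

  ↓-shift-upper : ∀ b N m a → a + N ≤ suc b → a ↓ m * suc b ^ (m * N) ≤ (a + N) ↓ m * b ^ (m * N)
  ↓-shift-upper b N zero    a       _      = ≤-refl
  ↓-shift-upper b N (suc m) zero    _      = z≤n
  ↓-shift-upper b N (suc m) (suc a) a+N≤n = begin
    suc a * a ↓ m * suc b ^ (N + m * N)
      ≡⟨ cong (suc a * a ↓ m *_) (^-distribˡ-+-* (suc b) N (m * N)) ⟩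
    suc a * a ↓ m * (suc b ^ N * suc b ^ (m * N))
      ≡⟨ interchange (suc a) (a ↓ m) (suc b ^ N) (suc b ^ (m * N)) ⟩
    (suc a * suc b ^ N) * (a ↓ m * suc b ^ (m * N))
      ≤⟨ *-mono-≤ (shift-factor-upper b (suc a) N a+N≤n) (↓-shift-upper b N m a (≤-trans (n≤1+n _) a+N≤n)) ⟩
    ((suc a + N) * b ^ N) * ((a + N) ↓ m * b ^ (m * N))
      ≡⟨ interchange (suc a + N) ((a + N) ↓ m) (b ^ N) (b ^ (m * N)) ⟨
    (suc a + N) * (a + N) ↓ m * (b ^ N * b ^ (m * N))
      ≡⟨ cong ((suc a + N) * (a + N) ↓ m *_) (^-distribˡ-+-* b N (m * N)) ⟨
    (suc a + N) * (a + N) ↓ m * b ^ (N + m * N)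
      ∎
    where open ≤-Reasoning

  shift-step-lower : ∀ c N n D → c ≤ n → N * (n ∸ c) * D ≤ c * n → (c + N) * n * D ≤ c * (n + N) * suc D
  shift-step-lower c N n D c≤n h = subst (λ n → (c + N) * n * D ≤ c * (n + N) * suc D) (m+[n∸m]≡n c≤n) (begin
    (c + N) * (c + t) * D                        ≡⟨ expand c N t D ⟩
    (c * (c + t) * D + c * N * D) + N * t * D    ≤⟨ +-monoʳ-≤ (c * (c + t) * D + c * N * D) h′ ⟩
    (c * (c + t) * D + c * N * D) + c * (c + t)  ≤⟨ m≤m+n _ (c * N) ⟩
    (c * (c + t) * D + c * N * D) + c * (c + t) + c * N ≡⟨ collect c N t D ⟩
    c * ((c + t) + N) * suc D                    ∎)
    where
    open ≤-Reasoning
    t = n ∸ c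
    h′ : N * t * D ≤ c * (c + t)
    h′ = subst (λ n → N * t * D ≤ c * n) (sym (m+[n∸m]≡n c≤n)) h
    expand : ∀ c N t D → (c + N) * (c + t) * D ≡ (c * (c + t) * D + c * N * D) + N * t * D
    expand = solve-∀
    collect : ∀ c N t D → (c * (c + t) * D + c * N * D) + c * (c + t) + c * N ≡ c * ((c + t) + N) * suc D
    collect = solve-∀

  shift-factor-lower : ∀ b c N D → c + N ≤ suc b → N * (suc b ∸ c) * D ≤ c * suc b →
                       (c + N) * b ^ N * D ≤ c * suc b ^ N * suc D
  shift-factor-lower b c N D c+N≤n h = *-cancelʳ-≤ _ _ (suc b + N) (begin
    (c + N) * b ^ N * D * (suc b + N)      ≡⟨ gather-bᴺ (c + N) (b ^ N) D (suc b + N) ⟩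
    (c + N) * D * (b ^ N * (suc b + N))    ≤⟨ *-monoʳ-≤ ((c + N) * D) (bernoulli-inverse b N) ⟩
    (c + N) * D * (suc b * suc b ^ N)      ≡⟨ pull-nᴺ (c + N) D (suc b) (suc b ^ N) ⟩
    suc b ^ N * ((c + N) * suc b * D)      ≤⟨ *-monoʳ-≤ (suc b ^ N) (shift-step-lower c N (suc b) D c≤n h) ⟩
    suc b ^ N * (c * (suc b + N) * suc D)  ≡⟨ push-nᴺ c (suc b ^ N) (suc D) (suc b + N) ⟩
    c * suc b ^ N * suc D * (suc b + N)    ∎)
    where
    open ≤-Reasoning
    c≤n : c ≤ suc b
    c≤n = ≤-trans (m≤m+n c N) c+N≤n
    gather-bᴺ : ∀ a p d q → a * p * d * q ≡ a * d * (p * q)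
    gather-bᴺ = solve-∀
    pull-nᴺ : ∀ a d n p → a * d * (n * p) ≡ p * (a * n * d)
    pull-nᴺ = solve-∀
    push-nᴺ : ∀ c p d q → p * (c * q * d) ≡ c * p * d * q
    push-nᴺ = solve-∀

  ↓-shift-lower : ∀ b N D c₀ m a → a + N ≤ suc b → c₀ + m ≤ a →
                  (∀ c → c₀ < c → c + N ≤ suc b → N * (suc b ∸ c) * D ≤ c * suc b) →
                  (a + N) ↓ m * b ^ (m * N) * D ^ m ≤ a ↓ m * suc b ^ (m * N) * suc D ^ m
  ↓-shift-lower b N D c₀ zero    a       _      _        _  = ≤-refl
  ↓-shift-lower b N D c₀ (suc m) zero    _      c₀+m≤0   _  = contradiction (≤-trans (≤-reflexive (sym (+-suc c₀ m))) c₀+m≤0) λ ()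
  ↓-shift-lower b N D c₀ (suc m) (suc a) a+N≤n c₀+m≤a  hyp = begin
    (suc a + N) * (a + N) ↓ m * b ^ (N + m * N) * (D * D ^ m)
      ≡⟨ cong (λ t → (suc a + N) * (a + N) ↓ m * t * (D * D ^ m)) (^-distribˡ-+-* b N (m * N)) ⟩
    (suc a + N) * (a + N) ↓ m * (b ^ N * b ^ (m * N)) * (D * D ^ m)
      ≡⟨ regroup (suc a + N) ((a + N) ↓ m) (b ^ N) (b ^ (m * N)) D (D ^ m) ⟩
    ((suc a + N) * b ^ N * D) * ((a + N) ↓ m * b ^ (m * N) * D ^ m)
      ≤⟨ *-mono-≤ (shift-factor-lower b (suc a) N D a+N≤n (hyp (suc a) (s≤s c₀≤a) a+N≤n))
                  (↓-shift-lower b N D c₀ m a (≤-trans (n≤1+n _) a+N≤n) c₀+m≤a′ hyp) ⟩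
    (suc a * suc b ^ N * suc D) * (a ↓ m * suc b ^ (m * N) * suc D ^ m)
      ≡⟨ regroup (suc a) (a ↓ m) (suc b ^ N) (suc b ^ (m * N)) (suc D) (suc D ^ m) ⟨
    suc a * a ↓ m * (suc b ^ N * suc b ^ (m * N)) * (suc D * suc D ^ m)
      ≡⟨ cong (λ t → suc a * a ↓ m * t * (suc D * suc D ^ m)) (^-distribˡ-+-* (suc b) N (m * N)) ⟨
    suc a * a ↓ m * suc b ^ (N + m * N) * (suc D * suc D ^ m)
      ∎
    where
    open ≤-Reasoning
    c₀+m≤a′ : c₀ + m ≤ a
    c₀+m≤a′ = s≤s⁻¹ (≤-trans (≤-reflexive (sym (+-suc c₀ m))) c₀+m≤a)
    c₀≤a : c₀ ≤ a
    c₀≤a = ≤-trans (m≤m+n c₀ m) c₀+m≤a′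
    regroup : ∀ a f x y d e → a * f * (x * y) * (d * e) ≡ (a * x * d) * (f * y * e)
    regroup = solve-∀

  square-perturb : ∀ d x y → x * (2 * suc d) ≤ x + y → d * ((x + y) * (x + y)) ≤ suc d * (y * y)
  square-perturb d x y h = begin
    d * ((x + y) * (x + y))                              ≡⟨ expand d x y ⟩
    d * (y * y) + 2 * d * x * y + d * (x * x)            ≤⟨ +-monoʳ-≤ (d * (y * y) + 2 * d * x * y)
                                                              (≤-trans (m≤m+n (d * (x * x)) _) (≤-reflexive (sym (split-x² d x)))) ⟩
    d * (y * y) + 2 * d * x * y + x * (suc (2 * d) * x)  ≤⟨ +-monoʳ-≤ (d * (y * y) + 2 * d * x * y) (*-monoʳ-≤ x [2d+1]x≤y) ⟩
    d * (y * y) + 2 * d * x * y + x * y                  ≡⟨ regroup d x y ⟩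
    d * (y * y) + y * (suc (2 * d) * x)                  ≤⟨ +-monoʳ-≤ (d * (y * y)) (*-monoʳ-≤ y [2d+1]x≤y) ⟩
    d * (y * y) + y * y                                  ≡⟨ +-comm (d * (y * y)) (y * y) ⟩
    suc d * (y * y)                                      ∎
    where
    open ≤-Reasoning
    unfold : ∀ x d → x * (2 * suc d) ≡ x + suc (2 * d) * x
    unfold = solve-∀
    expand : ∀ d x y → d * ((x + y) * (x + y)) ≡ d * (y * y) + 2 * d * x * y + d * (x * x)
    expand = solve-∀
    split-x² : ∀ d x → x * (suc (2 * d) * x) ≡ d * (x * x) + suc d * (x * x)
    split-x² = solve-∀
    regroup : ∀ d x y → d * (y * y) + 2 * d * x * y + x * y ≡ d * (y * y) + y * (suc (2 * d) * x)
    regroup = solve-∀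
    [2d+1]x≤y : suc (2 * d) * x ≤ y
    [2d+1]x≤y = +-cancelˡ-≤ x _ _ (subst (_≤ x + y) (unfold x d) h)

  infix 4 _≲[_]_

  -- a ≲[ d ] b says a ≤ (1 + 1/d) b. It is a record so that a, d and b can be inferred.
  record _≲[_]_ (a d b : ℕ) : Set where
    constructor mk≲
    field ≲-cross : d * a ≤ suc d * b

  filled-rows-upper : ∀ b N′ k m d → suc N′ ≡ m + k → suc N′ ≤ suc b → k * suc N′ * (2 * suc d) ≤ suc b →
                      suc b ^ (k * suc N′) ≲[ d ] (suc b ∸ m) ↓ k * b ^ (k * N′)
  filled-rows-upper b N′ k m d N≡m+k N≤n kN≪n = mk≲ $ *-cancelʳ-≤ _ _ (n * n) (begin
    d * n ^ (k * N) * (n * n)                  ≡⟨ xy∙z≈y∙xz d (n ^ (k * N)) (n * n) ⟩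
    n ^ (k * N) * (d * (n * n))                ≤⟨ *-monoʳ-≤ (n ^ (k * N)) n²≲[n∸kN]² ⟩
    n ^ (k * N) * (suc d * (n∸kN * n∸kN))      ≡⟨ cong (λ t → t * (suc d * (n∸kN * n∸kN))) n^kN≡ ⟩
    (n ^ k * n ^ e) * (suc d * (n∸kN * n∸kN))  ≡⟨ pair-up (n ^ k) (n ^ e) d n∸kN ⟩
    suc d * ((n ^ k * n∸kN) * (n ^ e * n∸kN))  ≤⟨ *-monoʳ-≤ (suc d) (*-mono-≤ free-columns row-powers) ⟩
    suc d * ((n * (n ∸ m) ↓ k) * (n * b ^ e))  ≡⟨ regroup d n ((n ∸ m) ↓ k) (b ^ e) ⟩
    suc d * ((n ∸ m) ↓ k * b ^ e) * (n * n)    ∎)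
    where
    open ≤-Reasoning
    n = suc b
    N = suc N′
    e = k * N′
    n∸kN = n ∸ k * N
    kN≤n : k * N ≤ n
    kN≤n = ≤-trans (m≤m*n (k * N) (2 * suc d)) kN≪n
    n²≲[n∸kN]² : d * (n * n) ≤ suc d * (n∸kN * n∸kN)
    n²≲[n∸kN]² = subst (λ t → d * (t * t) ≤ suc d * (n∸kN * n∸kN)) (m+[n∸m]≡n kN≤n)
      (square-perturb d (k * N) n∸kN (subst (k * N * (2 * suc d) ≤_) (sym (m+[n∸m]≡n kN≤n)) kN≪n))
    n^kN≡ : n ^ (k * N) ≡ n ^ k * n ^ e
    n^kN≡ = trans (cong (n ^_) (*-suc k N′)) (^-distribˡ-+-* n k e)
    free-columns : n ^ k * n∸kN ≤ n * (n ∸ m) ↓ k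
    free-columns = ≤-trans
      (subst (λ t → t ^ k * (t ∸ k * N) ≤ t * (n ∸ N) ^ k) (m+[n∸m]≡n N≤n) (bernoulli N (n ∸ N) k))
      (*-monoʳ-≤ n (subst (λ t → t ^ k ≤ (n ∸ m) ↓ k) (trans (∸-+-assoc n m k) (cong (n ∸_) (sym N≡m+k)))
                          (↓-lower (n ∸ m) k)))
    row-powers : n ^ e * n∸kN ≤ n * b ^ e
    row-powers = ≤-trans
      (*-monoʳ-≤ (n ^ e) (∸-monoʳ-≤ n (≤-trans (≤-reflexive (*-identityʳ e)) (*-monoʳ-≤ k (n≤1+n N′)))))
      (bernoulli 1 b e)
    pair-up : ∀ p q d t → (p * q) * (suc d * (t * t)) ≡ suc d * ((p * t) * (q * t))
    pair-up = solve-∀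
    regroup : ∀ d n f g → suc d * ((n * f) * (n * g)) ≡ suc d * (f * g) * (n * n)
    regroup = solve-∀

  filled-rows-lower : ∀ b N′ k m → (suc b ∸ m) ↓ k * b ^ (k * N′) ≤ suc b ^ (k * suc N′)
  filled-rows-lower b N′ k m = begin
    (suc b ∸ m) ↓ k * b ^ (k * N′) ≤⟨ *-mono-≤ (≤-trans (↓-upper (suc b ∸ m) k) (^-monoˡ-≤ k (m∸n≤m (suc b) m)))
                                               (^-monoˡ-≤ (k * N′) (n≤1+n b)) ⟩
    suc b ^ k * suc b ^ (k * N′)   ≡⟨ ^-distribˡ-+-* (suc b) k (k * N′) ⟨
    suc b ^ (k + k * N′)           ≡⟨ cong (suc b ^_) (*-suc k N′) ⟨
    suc b ^ (k * suc N′)           ∎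
    where open ≤-Reasoning

  m∸2n+n≡m∸n : ∀ m n → 2 * n ≤ m → m ∸ 2 * n + n ≡ m ∸ n
  m∸2n+n≡m∸n m n 2n≤m = begin
    m ∸ 2 * n + n            ≡⟨ m+n∸m≡n n (m ∸ 2 * n + n) ⟨
    n + (m ∸ 2 * n + n) ∸ n  ≡⟨ cong (_∸ n) (trans (rearrange n (m ∸ 2 * n)) (m+[n∸m]≡n 2n≤m)) ⟩
    m ∸ n                    ∎
    where
    open ≡-Reasoning
    rearrange : ∀ n r → n + (r + n) ≡ 2 * n + r
    rearrange = solve-∀

  empty-rows-upper : ∀ b N m → N ≤ suc b → (suc b ∸ N) ↓ m * suc b ^ (m * N) ≤ suc b ↓ m * b ^ (m * N)
  empty-rows-upper b N m N≤n = subst (λ t → (suc b ∸ N) ↓ m * suc b ^ (m * N) ≤ t ↓ m * b ^ (m * N)) (m∸n+n≡m N≤n)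
    (↓-shift-upper b N m (suc b ∸ N) (≤-reflexive (m∸n+n≡m N≤n)))

  -- Each empty row costs at most a factor 1 + 1/D with D = (d + 1) N, and there are m ≤ N of them.
  empty-rows-lower : ∀ b N′ m d → m ≤ suc N′ → 2 * suc N′ ≤ suc b →
                     suc N′ * (2 * suc N′) * (suc d * suc N′) ≤ (suc b ∸ 2 * suc N′) * suc b →
                     suc b ↓ m * b ^ (m * suc N′) ≲[ d ] (suc b ∸ suc N′) ↓ m * suc b ^ (m * suc N′)
  empty-rows-lower b N′ m d m≤N 2N≤n N³≪n² = mk≲ $ *-cancelʳ-≤ _ _ N (begin
    d * X * N        ≡⟨ xy∙z≈y∙xz d X N ⟩
    X * (d * N)      ≡⟨ cong (X *_) (m+n∸m≡n N (d * N)) ⟨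
    X * (D ∸ N)      ≤⟨ *-monoʳ-≤ X (∸-monoʳ-≤ D m≤N) ⟩
    X * (D ∸ m)      ≤⟨ X[D∸m]≤YD ⟩
    Y * D            ≡⟨ x∙yz≈yx∙z Y (suc d) N ⟩
    suc d * Y * N    ∎)
    where
    open ≤-Reasoning
    n = suc b
    N = suc N′
    D = suc d * N
    X = n ↓ m * b ^ (m * N)
    Y = (n ∸ N) ↓ m * n ^ (m * N)
    N≤n : N ≤ n
    N≤n = ≤-trans (m≤m+n N (N + 0)) 2N≤n
    n∸N+N≡n : n ∸ N + N ≡ n
    n∸N+N≡n = m∸n+n≡m N≤n
    per-row : ∀ c → n ∸ 2 * N < c → c + N ≤ n → N * (n ∸ c) * D ≤ c * n
    per-row c c>n∸2N _ = ≤-trans (*-monoˡ-≤ D (*-monoʳ-≤ N n∸c≤2N)) (≤-trans N³≪n² (*-monoˡ-≤ n (<⇒≤ c>n∸2N)))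
      where
      n∸c≤2N : n ∸ c ≤ 2 * N
      n∸c≤2N = ≤-trans (∸-monoʳ-≤ n (<⇒≤ c>n∸2N)) (≤-reflexive (m∸[m∸n]≡n 2N≤n))
    XDᵐ≤YD⁺ᵐ : X * D ^ m ≤ Y * suc D ^ m
    XDᵐ≤YD⁺ᵐ = subst (λ t → t ↓ m * b ^ (m * N) * D ^ m ≤ Y * suc D ^ m) n∸N+N≡n
      (↓-shift-lower b N D (n ∸ 2 * N) m (n ∸ N) (≤-reflexive n∸N+N≡n)
        (≤-trans (+-monoʳ-≤ (n ∸ 2 * N) m≤N) (≤-reflexive (m∸2n+n≡m∸n n N 2N≤n))) per-row)
    instance
      Dᵐ≢0 : NonZero (D ^ m)
      Dᵐ≢0 = m^n≢0 D m
    X[D∸m]≤YD : X * (D ∸ m) ≤ Y * D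
    X[D∸m]≤YD = *-cancelʳ-≤ _ _ (D ^ m) (begin
      X * (D ∸ m) * D ^ m        ≡⟨ xy∙z≈xz∙y X (D ∸ m) (D ^ m) ⟩
      X * D ^ m * (D ∸ m)        ≤⟨ *-monoˡ-≤ (D ∸ m) XDᵐ≤YD⁺ᵐ ⟩
      Y * suc D ^ m * (D ∸ m)    ≡⟨ *-assoc Y (suc D ^ m) (D ∸ m) ⟩
      Y * (suc D ^ m * (D ∸ m))  ≤⟨ *-monoʳ-≤ Y (bernoulli-reciprocal D m) ⟩
      Y * (D * D ^ m)            ≡⟨ *-assoc Y D (D ^ m) ⟨
      Y * D * D ^ m              ∎)

  ≤-*-≲ : ∀ {d a b x y} → a ≤ b → x ≲[ d ] y → a * x ≲[ d ] b * y
  ≤-*-≲ {d} {a} {b} {x} {y} a≤b (mk≲ x≲y) = mk≲ $ begin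
    d * (a * x)      ≡⟨ x∙yz≈y∙xz d a x ⟩
    a * (d * x)      ≤⟨ *-mono-≤ a≤b x≲y ⟩
    b * (suc d * y)  ≡⟨ x∙yz≈y∙xz b (suc d) y ⟩
    suc d * (b * y)  ∎
    where open ≤-Reasoning

  ≲-*-≤ : ∀ {d a b x y} → x ≲[ d ] y → a ≤ b → x * a ≲[ d ] y * b
  ≲-*-≤ {d} {a} {b} {x} {y} (mk≲ x≲y) a≤b = mk≲ $ begin
    d * (x * a)      ≡⟨ *-assoc d x a ⟨
    d * x * a        ≤⟨ *-mono-≤ x≲y a≤b ⟩
    suc d * y * b    ≡⟨ *-assoc (suc d) y b ⟩
    suc d * (y * b)  ∎
    where open ≤-Reasoning

  infix 4 _≈[_]_

  _≈[_]_ : ℕ → ℕ → ℕ → Set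
  a ≈[ d ] b = a ≲[ d ] b × b ≲[ d ] a

  ≈-*ʳ : ∀ {d a b} c → a ≈[ d ] b → a * c ≈[ d ] b * c
  ≈-*ʳ c (a≲b , b≲a) = ≲-*-≤ a≲b ≤-refl , ≲-*-≤ b≲a ≤-refl

  record Regime (n N k d : ℕ) : Set where
    field
      4N≤n : 4 * N ≤ n
      kN≪n : k * N * (2 * suc d) ≤ n
      N³≪n² : N * (2 * N) * (suc d * N) ≤ (n ∸ 2 * N) * n

  N²≡ : ∀ N m k → N ≡ m + k → N * N ≡ m * N + k * N
  N²≡ N m k N≡m+k = trans (cong (_* N) N≡m+k) (*-distribʳ-+ N m k)

  N²∸k≡ : ∀ N′ m k → suc N′ ≡ m + k → suc N′ * suc N′ ∸ k ≡ m * suc N′ + k * N′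
  N²∸k≡ N′ m k N≡m+k = begin
    suc N′ * suc N′ ∸ k             ≡⟨ cong (_∸ k) (N²≡ (suc N′) m k N≡m+k) ⟩
    m * suc N′ + k * suc N′ ∸ k     ≡⟨ cong (λ t → m * suc N′ + t ∸ k) (trans (*-suc k N′) (+-comm k (k * N′))) ⟩
    m * suc N′ + (k * N′ + k) ∸ k   ≡⟨ cong (_∸ k) (+-assoc (m * suc N′) (k * N′) k) ⟨
    m * suc N′ + k * N′ + k ∸ k     ≡⟨ m+n∸n≡m (m * suc N′ + k * N′) k ⟩
    m * suc N′ + k * N′             ∎
    where open ≡-Reasoning

  permutation≈bernoulli : ∀ b N′ k m d → suc N′ ≡ m + k → Regime (suc b) (suc N′) k d →
    (suc b ∸ suc N′) ↓ m * suc b ^ (suc N′ * suc N′) ≈[ d ] suc b ↓ suc N′ * b ^ (suc N′ * suc N′ ∸ k)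
  permutation≈bernoulli b N′ k m d N≡m+k R = upper , lower
    where
    open Regime R
    n = suc b
    N = suc N′
    2N≤n : 2 * N ≤ n
    2N≤n = ≤-trans (*-monoˡ-≤ N {2} {4} (s≤s (s≤s z≤n))) 4N≤n
    N≤n : N ≤ n
    N≤n = ≤-trans (m≤m+n N (N + 0)) 2N≤n
    m≤N : m ≤ N
    m≤N = ≤-trans (m≤m+n m k) (≤-reflexive (sym N≡m+k))
    lhs≡ : (n ∸ N) ↓ m * n ^ (N * N) ≡ ((n ∸ N) ↓ m * n ^ (m * N)) * n ^ (k * N)
    lhs≡ = begin
      (n ∸ N) ↓ m * n ^ (N * N)                      ≡⟨ cong (λ e → (n ∸ N) ↓ m * n ^ e) (N²≡ N m k N≡m+k) ⟩
      (n ∸ N) ↓ m * n ^ (m * N + k * N)              ≡⟨ cong ((n ∸ N) ↓ m *_) (^-distribˡ-+-* n (m * N) (k * N)) ⟩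
      (n ∸ N) ↓ m * (n ^ (m * N) * n ^ (k * N))      ≡⟨ *-assoc ((n ∸ N) ↓ m) _ _ ⟨
      ((n ∸ N) ↓ m * n ^ (m * N)) * n ^ (k * N)      ∎
      where open ≡-Reasoning
    rhs≡ : n ↓ N * b ^ (N * N ∸ k) ≡ (n ↓ m * b ^ (m * N)) * ((n ∸ m) ↓ k * b ^ (k * N′))
    rhs≡ = begin
      n ↓ N * b ^ (N * N ∸ k)                                ≡⟨ cong₂ (λ x e → n ↓ x * b ^ e) N≡m+k (N²∸k≡ N′ m k N≡m+k) ⟩
      n ↓ (m + k) * b ^ (m * N + k * N′)                     ≡⟨ cong₂ _*_ (↓-split n m k) (^-distribˡ-+-* b (m * N) (k * N′)) ⟩
      (n ↓ m * (n ∸ m) ↓ k) * (b ^ (m * N) * b ^ (k * N′))   ≡⟨ interchange (n ↓ m) ((n ∸ m) ↓ k) (b ^ (m * N)) (b ^ (k * N′)) ⟩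
      (n ↓ m * b ^ (m * N)) * ((n ∸ m) ↓ k * b ^ (k * N′))   ∎
      where open ≡-Reasoning
    upper : (n ∸ N) ↓ m * n ^ (N * N) ≲[ d ] n ↓ N * b ^ (N * N ∸ k)
    upper = subst₂ _≲[ d ]_ (sym lhs≡) (sym rhs≡)
      (≤-*-≲ (empty-rows-upper b N m N≤n) (filled-rows-upper b N′ k m d N≡m+k N≤n kN≪n))
    lower : n ↓ N * b ^ (N * N ∸ k) ≲[ d ] (n ∸ N) ↓ m * n ^ (N * N)
    lower = subst₂ _≲[ d ]_ (sym rhs≡) (sym lhs≡)
      (≲-*-≤ (empty-rows-lower b N′ m d m≤N 2N≤n N³≪n²) (filled-rows-lower b N′ k m))

  ^-distribʳ-* : ∀ a c e → (a * c) ^ e ≡ a ^ e * c ^ e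
  ^-distribʳ-* a c zero    = refl
  ^-distribʳ-* a c (suc e) = trans (cong (a * c *_) (^-distribʳ-* a c e)) (interchange a c (a ^ e) (c ^ e))

  ^-cancelˡ-≤ : ∀ e {a c} → a ^ suc e ≤ c ^ suc e → a ≤ c
  ^-cancelˡ-≤ e {a} {c} aᵉ≤cᵉ with a ≤? c
  ... | yes a≤c = a≤c
  ... | no  a≰c = contradiction aᵉ≤cᵉ (<⇒≱ (^-monoˡ-< (suc e) (≰⇒> a≰c)))

  *-≤-of-^5 : ∀ c x n → x ^ 5 ≤ n ^ 4 → c ^ 5 ≤ n → c * x ≤ n
  *-≤-of-^5 c x n x⁵≤n⁴ c⁵≤n = ^-cancelˡ-≤ 4 (begin
    (c * x) ^ 5    ≡⟨ ^-distribʳ-* c x 5 ⟩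
    c ^ 5 * x ^ 5  ≤⟨ *-mono-≤ c⁵≤n x⁵≤n⁴ ⟩
    n * n ^ 4      ∎)
    where open ≤-Reasoning

  N¹²≤n⁷⇒N⁵≤n³ : ∀ N n .{{_ : NonZero n}} → N ^ 12 ≤ n ^ 7 → N ^ 5 ≤ n ^ 3
  N¹²≤n⁷⇒N⁵≤n³ N n N¹²≤n⁷ = ^-cancelˡ-≤ 11 (begin
    (N ^ 5) ^ 12  ≡⟨ ^-*-assoc N 5 12 ⟩
    N ^ 60        ≡⟨ ^-*-assoc N 12 5 ⟨
    (N ^ 12) ^ 5  ≤⟨ ^-monoˡ-≤ 5 N¹²≤n⁷ ⟩
    (n ^ 7) ^ 5   ≡⟨ ^-*-assoc n 7 5 ⟩
    n ^ 35        ≤⟨ ^-monoʳ-≤ n (n≤1+n 35) ⟩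
    n ^ 36        ≡⟨ ^-*-assoc n 3 12 ⟨
    (n ^ 3) ^ 12  ∎)
    where open ≤-Reasoning

  *-cube-≤ : ∀ c N n → c ^ 5 ≤ n → N ^ 5 ≤ n ^ 3 → c * (N * N * N) ≤ n * n
  *-cube-≤ c N n c⁵≤n N⁵≤n³ = ^-cancelˡ-≤ 4 (begin
    (c * (N * N * N)) ^ 5            ≡⟨ ^-distribʳ-* c (N * N * N) 5 ⟩
    c ^ 5 * (N * N * N) ^ 5          ≡⟨ cong (c ^ 5 *_) (trans (^-distribʳ-* (N * N) N 5) (cong (_* N ^ 5) (^-distribʳ-* N N 5))) ⟩
    c ^ 5 * (N ^ 5 * N ^ 5 * N ^ 5)  ≤⟨ *-mono-≤ c⁵≤n (*-mono-≤ (*-mono-≤ N⁵≤n³ N⁵≤n³) N⁵≤n³) ⟩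
    n * (n ^ 3 * n ^ 3 * n ^ 3)      ≡⟨ cong (n *_) (trans (cong (_* n ^ 3) (sym (^-distribˡ-+-* n 3 3)))
                                                           (sym (^-distribˡ-+-* n 6 3))) ⟩
    n ^ (5 + 5)                      ≡⟨ ^-distribˡ-+-* n 5 5 ⟩
    n ^ 5 * n ^ 5                    ≡⟨ ^-distribʳ-* n n 5 ⟨
    (n * n) ^ 5                      ∎)
    where open ≤-Reasoning

  4n≤m⇒m≤2[m∸2n] : ∀ m n → 4 * n ≤ m → m ≤ 2 * (m ∸ 2 * n)
  4n≤m⇒m≤2[m∸2n] m n 4n≤m = begin
    m                        ≡⟨ m∸n+n≡m 2n≤m ⟨
    m ∸ 2 * n + 2 * n        ≤⟨ +-monoʳ-≤ (m ∸ 2 * n) (+-cancelʳ-≤ (2 * n) _ _ 4n≤m∸2n+2n) ⟩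
    m ∸ 2 * n + (m ∸ 2 * n)  ≡⟨ twice (m ∸ 2 * n) ⟩
    2 * (m ∸ 2 * n)          ∎
    where
    open ≤-Reasoning
    twice : ∀ x → x + x ≡ 2 * x
    twice = solve-∀
    4n≡ : ∀ n → 2 * n + 2 * n ≡ 4 * n
    4n≡ = solve-∀
    2n≤m : 2 * n ≤ m
    2n≤m = ≤-trans (*-monoˡ-≤ n {2} {4} (s≤s (s≤s z≤n))) 4n≤m
    4n≤m∸2n+2n : 2 * n + 2 * n ≤ m ∸ 2 * n + 2 * n
    4n≤m∸2n+2n = subst₂ _≤_ (sym (4n≡ n)) (sym (m∸n+n≡m 2n≤m)) 4n≤m

  regime : ∀ n N k d .{{_ : NonZero n}} → N ^ 12 ≤ n ^ 7 → k ^ 5 ≤ n → (4 * suc d) ^ 5 ≤ n → Regime n N k d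
  regime n N k d N¹²≤n⁷ k⁵≤n c⁵≤n = record { 4N≤n = 4N≤n ; kN≪n = kN≪n ; N³≪n² = N³≪n² }
    where
    open ≤-Reasoning
    c = 4 * suc d
    N⁵≤n³ : N ^ 5 ≤ n ^ 3
    N⁵≤n³ = N¹²≤n⁷⇒N⁵≤n³ N n N¹²≤n⁷
    4N≤n : 4 * N ≤ n
    4N≤n = ≤-trans (*-monoˡ-≤ N (m≤m*n 4 (suc d))) (*-≤-of-^5 c N n (≤-trans N⁵≤n³ (^-monoʳ-≤ n (n≤1+n 3))) c⁵≤n)
    kN≪n : k * N * (2 * suc d) ≤ n
    kN≪n = begin
      k * N * (2 * suc d)  ≡⟨ *-comm (k * N) (2 * suc d) ⟩
      2 * suc d * (k * N)  ≤⟨ *-monoˡ-≤ (k * N) (*-monoˡ-≤ (suc d) {2} {4} (s≤s (s≤s z≤n))) ⟩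
      c * (k * N)          ≤⟨ *-≤-of-^5 c (k * N) n (≤-trans (≤-reflexive (^-distribʳ-* k N 5)) (*-mono-≤ k⁵≤n N⁵≤n³)) c⁵≤n ⟩
      n                    ∎
    N³≪n² : N * (2 * N) * (suc d * N) ≤ (n ∸ 2 * N) * n
    N³≪n² = *-cancelˡ-≤ 2 (begin
      2 * (N * (2 * N) * (suc d * N))  ≡⟨ cube (suc d) N ⟩
      c * (N * N * N)                  ≤⟨ *-cube-≤ c N n c⁵≤n N⁵≤n³ ⟩
      n * n                            ≤⟨ *-monoˡ-≤ n (4n≤m⇒m≤2[m∸2n] n N 4N≤n) ⟩
      2 * (n ∸ 2 * N) * n              ≡⟨ *-assoc 2 (n ∸ 2 * N) n ⟩
      2 * ((n ∸ 2 * N) * n)            ∎)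
      where
      cube : ∀ s N → 2 * (N * (2 * N) * (s * N)) ≡ 4 * s * (N * N * N)
      cube = solve-∀

  largestUpTo-≤ : ∀ P k → largestUpTo P k ≤ k
  largestUpTo-≤ P zero    = z≤n
  largestUpTo-≤ P (suc k) with P (suc k)
  ... | true  = ≤-refl
  ... | false = m≤n⇒m≤1+n (largestUpTo-≤ P k)

  largestUpTo-satisfies : ∀ P k → P (largestUpTo P k) ≡ true ⊎ largestUpTo P k ≡ 0
  largestUpTo-satisfies P zero    = inj₂ refl
  largestUpTo-satisfies P (suc k) with P (suc k) in Pk
  ... | true  = inj₁ Pk
  ... | false = largestUpTo-satisfies P k

  largestUpTo-≥ : ∀ P k j → j ≤ k → P j ≡ true → j ≤ largestUpTo P k
  largestUpTo-≥ P zero    j j≤k Pj = j≤k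
  largestUpTo-≥ P (suc k) j j≤k Pj with P (suc k) in Pk
  ... | true  = j≤k
  ... | false with m≤n⇒m<n∨m≡n j≤k
  ...   | inj₁ j<1+k = largestUpTo-≥ P k j (s≤s⁻¹ j<1+k) Pj
  ...   | inj₂ refl  = contradiction (trans (sym Pj) Pk) λ ()

  floorN≤n : ∀ n → floorN n ≤ n
  floorN≤n n = largestUpTo-≤ _ n

  floorN^12≤n^7 : ∀ n → floorN n ^ 12 ≤ n ^ 7
  floorN^12≤n^7 n with largestUpTo-satisfies (λ m → m ^ 12 ≤ᵇ n ^ 7) n
  ... | inj₁ sat = ≤ᵇ⇒≤ _ _ (subst T (sym sat) _)
  ... | inj₂ ≡0  = subst (λ t → t ^ 12 ≤ n ^ 7) (sym ≡0) z≤n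

  floorN>0 : ∀ n → .{{NonZero n}} → 0 < floorN n
  floorN>0 n@(suc _) = largestUpTo-≥ (λ m → m ^ 12 ≤ᵇ n ^ 7) n 1 (s≤s z≤n) (dec-true (1 ≤? n ^ 7) (m^n>0 n 7))

  𝟙 : Bool → ℕ
  𝟙 b = if b then 1 else 0

  count : ∀ {A : Set} → (A → Bool) → List A → ℕ
  count f []       = 0
  count f (x ∷ xs) = if f x then suc (count f xs) else count f xs

  count-cong : ∀ {A : Set} {f g : A → Bool} → (∀ x → f x ≡ g x) → ∀ xs → count f xs ≡ count g xs
  count-cong f≗g []       = refl
  count-cong {g = g} f≗g (x ∷ xs) rewrite f≗g x with g x
  ... | true  = cong suc (count-cong f≗g xs)
  ... | false = count-cong f≗g xs

  count-++ : ∀ {A : Set} (f : A → Bool) xs ys → count f (xs ++ ys) ≡ count f xs + count f ys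
  count-++ f []       ys = refl
  count-++ f (x ∷ xs) ys with f x
  ... | true  = cong suc (count-++ f xs ys)
  ... | false = count-++ f xs ys

  count-concatMap : ∀ {A B : Set} (f : B → Bool) (g : A → List B) xs →
                    count f (concatMap g xs) ≡ sum (map (count f ∘ g) xs)
  count-concatMap f g []       = refl
  count-concatMap f g (x ∷ xs) = trans (count-++ f (g x) (concatMap g xs)) (cong (count f (g x) +_) (count-concatMap f g xs))

  count-map : ∀ {A B : Set} (f : B → Bool) (h : A → B) xs → count f (map h xs) ≡ count (f ∘ h) xs
  count-map f h []       = refl
  count-map f h (x ∷ xs) with f (h x)
  ... | true  = cong suc (count-map f h xs)
  ... | false = count-map f h xs

  count-∧ : ∀ {A : Set} b (g : A → Bool) xs → count (λ x → b ∧ g x) xs ≡ (if b then count g xs else 0)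
  count-∧ true  g xs       = refl
  count-∧ false g []       = refl
  count-∧ false g (x ∷ xs) = count-∧ false g xs

  length-filter≡count : ∀ {A : Set} {P : A → Set} (P? : Decidable P) xs → length (filter P? xs) ≡ count (does ∘ P?) xs
  length-filter≡count P? []       = refl
  length-filter≡count P? (x ∷ xs) with does (P? x)
  ... | true  = cong suc (length-filter≡count P? xs)
  ... | false = length-filter≡count P? xs

  count-filter : ∀ {A : Set} {P : A → Set} (P? : Decidable P) (f : A → Bool) xs →
                 count f (filter P? xs) ≡ count (λ x → does (P? x) ∧ f x) xs
  count-filter P? f []       = refl
  count-filter P? f (x ∷ xs) with does (P? x)
  ... | false = count-filter P? f xs
  ... | true with f x
  ...   | true  = cong suc (count-filter P? f xs)
  ...   | false = count-filter P? f xs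

  sum< : ℕ → (ℕ → ℕ) → ℕ
  sum< zero    f = 0
  sum< (suc m) f = f 0 + sum< m (f ∘ suc)

  count< : ℕ → (ℕ → Bool) → ℕ
  count< m P = sum< m (𝟙 ∘ P)

  sum<-cong : ∀ m {f g : ℕ → ℕ} → (∀ y → y < m → f y ≡ g y) → sum< m f ≡ sum< m g
  sum<-cong zero    f≗g = refl
  sum<-cong (suc m) f≗g = cong₂ _+_ (f≗g 0 z<s) (sum<-cong m (λ y y<m → f≗g (suc y) (s<s y<m)))

  sum<-+ : ∀ m (f g : ℕ → ℕ) → sum< m f + sum< m g ≡ sum< m (λ y → f y + g y)
  sum<-+ zero    f g = refl
  sum<-+ (suc m) f g = trans (+-+-comm-pairs (f 0) (sum< m (f ∘ suc)) (g 0) (sum< m (g ∘ suc)))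
                             (cong (f 0 + g 0 +_) (sum<-+ m (f ∘ suc) (g ∘ suc)))
    where
    open import Algebra.Properties.CommutativeSemigroup +-commutativeSemigroup
      renaming (interchange to +-+-comm-pairs)

  sum<-const : ∀ m → sum< m (λ _ → 1) ≡ m
  sum<-const zero    = refl
  sum<-const (suc m) = cong suc (sum<-const m)

  sum-allFin≡sum< : ∀ m (g : ℕ → ℕ) → sum (map (g ∘ toℕ) (allFin m)) ≡ sum< m g
  sum-allFin≡sum< m g = trans (cong sum (List.map-tabulate {n = m} id (g ∘ toℕ))) (sum-tabulate m g)
    where
    sum-tabulate : ∀ m (g : ℕ → ℕ) → sum (tabulate {n = m} (g ∘ toℕ)) ≡ sum< m g
    sum-tabulate zero    g = refl
    sum-tabulate (suc m) g = cong (g 0 +_) (sum-tabulate m (g ∘ suc))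

  sum<-if : ∀ m (P : ℕ → Bool) c → sum< m (λ y → if P y then c else 0) ≡ c * count< m P
  sum<-if zero    P c = sym (*-zeroʳ c)
  sum<-if (suc m) P c with P 0
  ... | true  = trans (cong (c +_) (sum<-if m (P ∘ suc) c)) (sym (*-suc c (count< m (P ∘ suc))))
  ... | false = sum<-if m (P ∘ suc) c

  sum<-point : ∀ m (f : ℕ → ℕ) j → j < m → (∀ y → y < m → y ≢ j → f y ≡ 0) → sum< m f ≡ f j
  sum<-point (suc m) f zero    _       f≡0 = trans (cong (f 0 +_) (trans (sum<-cong m (λ y y<m → f≡0 (suc y) (s<s y<m) λ ())) (zeros m))) (+-identityʳ (f 0))
    where
    zeros : ∀ m → sum< m (λ _ → 0) ≡ 0
    zeros zero    = refl
    zeros (suc m) = zeros m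
  sum<-point (suc m) f (suc j) (s<s j<m) f≡0 = trans (cong (_+ sum< m (f ∘ suc)) (f≡0 0 z<s λ ()))
    (sum<-point m (f ∘ suc) j j<m (λ y y<m y≢j → f≡0 (suc y) (s<s y<m) (y≢j ∘ suc-injective)))

  count<-≥ : ∀ m N → count< m (N ≤ᵇ_) ≡ m ∸ N
  count<-≥ zero    N       = sym (0∸n≡0 N)
  count<-≥ (suc m) zero    = cong suc (count<-≥ m zero)
  count<-≥ (suc m) (suc N) = trans (sum<-cong m (λ y _ → cong 𝟙 (suc≤ᵇsuc N y))) (count<-≥ m N)
    where
    suc≤ᵇsuc : ∀ N y → (suc N ≤ᵇ suc y) ≡ (N ≤ᵇ y)
    suc≤ᵇsuc zero    y = refl
    suc≤ᵇsuc (suc N) y = refl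

  count<-complement : ∀ m (Q P : ℕ → Bool) → count< m (λ y → Q y ∧ not (P y)) + count< m (λ y → Q y ∧ P y) ≡ count< m Q
  count<-complement m Q P = trans (sum<-+ m _ _) (sum<-cong m (λ y _ → split (Q y) (P y)))
    where
    split : ∀ q p → 𝟙 (q ∧ not p) + 𝟙 (q ∧ p) ≡ 𝟙 q
    split true  true  = refl
    split true  false = refl
    split false p     = refl

  insert : (ℕ → Bool) → ℕ → ℕ → Bool
  insert U x y = U y ∨ (y ≡ᵇ x)

  count<-insert : ∀ m (Q U : ℕ → Bool) x → x < m → U x ≡ false →
                  count< m (λ y → Q y ∧ insert U x y) ≡ count< m (λ y → Q y ∧ U y) + 𝟙 (Q x)
  count<-insert (suc m) Q U zero _ U0≡false = begin
    𝟙 (Q 0 ∧ (U 0 ∨ true)) + count< m (λ y → Q (suc y) ∧ (U (suc y) ∨ false))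
      ≡⟨ cong₂ _+_ (cong (λ t → 𝟙 (Q 0 ∧ (t ∨ true))) U0≡false)
                   (sum<-cong m (λ y _ → cong (λ t → 𝟙 (Q (suc y) ∧ t)) (Bool.∨-identityʳ (U (suc y))))) ⟩
    𝟙 (Q 0 ∧ true) + R              ≡⟨ cong (λ t → 𝟙 t + R) (Bool.∧-identityʳ (Q 0)) ⟩
    𝟙 (Q 0) + R                     ≡⟨ +-comm (𝟙 (Q 0)) R ⟩
    R + 𝟙 (Q 0)                     ≡⟨ cong (λ t → 𝟙 t + R + 𝟙 (Q 0)) (trans (cong (Q 0 ∧_) U0≡false) (Bool.∧-zeroʳ (Q 0))) ⟨
    𝟙 (Q 0 ∧ U 0) + R + 𝟙 (Q 0)     ∎
    where
    open ≡-Reasoning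
    R = count< m (λ y → Q (suc y) ∧ U (suc y))
  count<-insert (suc m) Q U (suc x) (s<s x<m) Ux≡false = begin
    𝟙 (Q 0 ∧ (U 0 ∨ false)) + count< m (λ y → Q (suc y) ∧ insert (U ∘ suc) x y)
      ≡⟨ cong₂ _+_ (cong (λ t → 𝟙 (Q 0 ∧ t)) (Bool.∨-identityʳ (U 0))) (count<-insert m (Q ∘ suc) (U ∘ suc) x x<m Ux≡false) ⟩
    𝟙 (Q 0 ∧ U 0) + (count< m (λ y → Q (suc y) ∧ U (suc y)) + 𝟙 (Q (suc x)))
      ≡⟨ +-assoc (𝟙 (Q 0 ∧ U 0)) _ _ ⟨
    𝟙 (Q 0 ∧ U 0) + count< m (λ y → Q (suc y) ∧ U (suc y)) + 𝟙 (Q (suc x)) ∎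
    where open ≡-Reasoning

  ≡ᵇ-refl : ∀ j → (j ≡ᵇ j) ≡ true
  ≡ᵇ-refl j = dec-true (j ≟ j) refl

  ≢⇒≡ᵇ-false : ∀ y j → y ≢ j → (y ≡ᵇ j) ≡ false
  ≢⇒≡ᵇ-false y j = dec-false (y ≟ j)

  ≡ᵇ-true⇒≡ : ∀ y j → (y ≡ᵇ j) ≡ true → y ≡ j
  ≡ᵇ-true⇒≡ y j eq = ≡ᵇ⇒≡ y j (subst Data.Bool.T (sym eq) _)
    where import Data.Bool

  ≡ᵇ-sym : ∀ a c → (a ≡ᵇ c) ≡ (c ≡ᵇ a)
  ≡ᵇ-sym zero    zero    = refl
  ≡ᵇ-sym zero    (suc c) = refl
  ≡ᵇ-sym (suc a) zero    = refl
  ≡ᵇ-sym (suc a) (suc c) = ≡ᵇ-sym a c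

  does-Fin-≟ : ∀ {n} (x y : Fin n) → does (x Fin.≟ y) ≡ (toℕ x ≡ᵇ toℕ y)
  does-Fin-≟ x y with x Fin.≟ y
  ... | yes refl = sym (≡ᵇ-refl (toℕ x))
  ... | no  x≢y  = sym (≢⇒≡ᵇ-false (toℕ x) (toℕ y) (x≢y ∘ Fin.toℕ-injective))

  -- The constraint that row i of the N × N pattern puts on the column σ(i): the column of the
  -- one 1 of the row, some column ≥ N if the row is empty, and no constraint for rows i ≥ N.
  data Slot : Set where
    at     : ℕ → Slot
    beyond : Slot
    free   : Slot

  isBeyond : Slot → ℕ
  isBeyond beyond = 1
  isBeyond (at _) = 0
  isBeyond free   = 0

  module Counting (n N : ℕ) (N≤n : N ≤ n) where

    open import Data.List.Relation.Unary.Unique.DecPropositional (Fin._≟_ {n}) using (unique?)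

    fits : Slot → ℕ → Bool
    fits (at j) y = y ≡ᵇ j
    fits beyond y = N ≤ᵇ y
    fits free   y = true

    -- v lists the columns of the next k rows, and U is the set of columns taken by the earlier rows.
    Admissible : ∀ {k} → (ℕ → Slot) → (ℕ → Bool) → Vec (Fin n) k → Bool
    Admissible τ U []      = true
    Admissible τ U (x ∷ v) = fits (τ 0) (toℕ x) ∧ (not (U (toℕ x)) ∧ Admissible (τ ∘ suc) (insert U (toℕ x)) v)

    #admissible : (ℕ → Slot) → (ℕ → Bool) → ℕ → ℕ
    #admissible τ U k = count (Admissible τ U) (allVecs n k)

    #admissible-suc : ∀ τ U k t → τ 0 ≡ t → #admissible τ U (suc k) ≡
      sum< n (λ y → if fits t y then (if not (U y) then #admissible (τ ∘ suc) (insert U y) k else 0) else 0)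
    #admissible-suc τ U k t refl = begin
      count (Admissible τ U) (concatMap (λ x → map (x ∷_) (allVecs n k)) (allFin n))
        ≡⟨ count-concatMap (Admissible τ U) (λ x → map (x ∷_) (allVecs n k)) (allFin n) ⟩
      sum (map (λ x → count (Admissible τ U) (map (x ∷_) (allVecs n k))) (allFin n))
        ≡⟨ cong sum (List.map-cong first-column (allFin n)) ⟩
      sum (map (g ∘ toℕ) (allFin n))
        ≡⟨ sum-allFin≡sum< n g ⟩
      sum< n g ∎
      where
      open ≡-Reasoning
      g : ℕ → ℕ
      g y = if fits (τ 0) y then (if not (U y) then #admissible (τ ∘ suc) (insert U y) k else 0) else 0
      first-column : ∀ x → count (Admissible τ U) (map (x ∷_) (allVecs n k)) ≡ g (toℕ x)
      first-column x = trans (count-map (Admissible τ U) (x ∷_) (allVecs n k))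
        (trans (count-∧ (fits (τ 0) (toℕ x)) _ (allVecs n k))
               (cong (λ t → if fits (τ 0) (toℕ x) then t else 0) (count-∧ (not (U (toℕ x))) _ (allVecs n k))))

    -- The closed form of #admissible: u counts the columns taken so far and ub those of them that are ≥ N.
    mutual
      arrangements : (ℕ → Slot) → ℕ → ℕ → ℕ → ℕ
      arrangements τ zero    u ub = 1
      arrangements τ (suc k) u ub = arrangements-at (τ 0) (τ ∘ suc) k u ub

      arrangements-at : Slot → (ℕ → Slot) → ℕ → ℕ → ℕ → ℕ
      arrangements-at (at _) τ k u ub = arrangements τ k (suc u) ub
      arrangements-at beyond τ k u ub = (n ∸ N ∸ ub) * arrangements τ k (suc u) (suc ub)
      arrangements-at free   τ k u ub = (n ∸ u) * arrangements τ k (suc u) ub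

    arrangements-free : ∀ k τ u ub → (∀ i → τ i ≡ free) → arrangements τ k u ub ≡ (n ∸ u) ↓ k
    arrangements-free zero    τ u ub all-free = refl
    arrangements-free (suc k) τ u ub all-free rewrite all-free 0 =
      cong ((n ∸ u) *_) (trans (arrangements-free k (τ ∘ suc) (suc u) ub (all-free ∘ suc))
                               (cong (_↓ k) (sym (pred[m∸n]≡m∸[1+n] n u))))

    -- The conditions under which the number of choices for each slot does not depend on the earlier choices.
    record Consistent (τ : ℕ → Slot) (U : ℕ → Bool) : Set where
      field
        at<N         : ∀ i j → τ i ≡ at j → j < N
        at-injective : ∀ i i′ j → τ i ≡ at j → τ i′ ≡ at j → i ≡ i′
        at-unused    : ∀ i j → τ i ≡ at j → U j ≡ false
        free-suc     : ∀ i → τ i ≡ free → τ (suc i) ≡ free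

    open Consistent

    consistent-at : ∀ {τ U j} → Consistent τ U → τ 0 ≡ at j → Consistent (τ ∘ suc) (insert U j)
    consistent-at {τ} {U} {j} c τ0≡at = record
      { at<N         = λ i → at<N c (suc i)
      ; at-injective = λ i i′ j′ p q → suc-injective (at-injective c (suc i) (suc i′) j′ p q)
      ; at-unused    = λ i j′ p → cong₂ _∨_ (at-unused c (suc i) j′ p)
                                    (≢⇒≡ᵇ-false j′ j λ { refl → 1+n≢0 (at-injective c (suc i) 0 j p τ0≡at) })
      ; free-suc     = λ i → free-suc c (suc i) }

    consistent-beyond : ∀ {τ U y} → Consistent τ U → N ≤ y → Consistent (τ ∘ suc) (insert U y)
    consistent-beyond {τ} {U} {y} c N≤y = record
      { at<N         = λ i → at<N c (suc i)
      ; at-injective = λ i i′ j′ p q → suc-injective (at-injective c (suc i) (suc i′) j′ p q)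
      ; at-unused    = λ i j′ p → cong₂ _∨_ (at-unused c (suc i) j′ p)
                                    (≢⇒≡ᵇ-false j′ y λ { refl → <⇒≱ (at<N c (suc i) j′ p) N≤y })
      ; free-suc     = λ i → free-suc c (suc i) }

    all-free : ∀ {τ U} → Consistent τ U → τ 0 ≡ free → ∀ i → τ i ≡ free
    all-free c τ0≡free zero    = τ0≡free
    all-free c τ0≡free (suc i) = free-suc c i (all-free c τ0≡free i)

    consistent-free : ∀ {τ U y} → Consistent τ U → τ 0 ≡ free → Consistent (τ ∘ suc) (insert U y)
    consistent-free c τ0≡free = record
      { at<N         = λ i → at<N c (suc i)
      ; at-injective = λ i i′ j′ p q → suc-injective (at-injective c (suc i) (suc i′) j′ p q)
      ; at-unused    = λ i j′ p → contradiction (trans (sym (all-free c τ0≡free (suc i))) p) λ ()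
      ; free-suc     = λ i → free-suc c (suc i) }

    #used : (ℕ → Bool) → ℕ
    #used U = count< n U

    #used-beyond : (ℕ → Bool) → ℕ
    #used-beyond U = count< n (λ y → (N ≤ᵇ y) ∧ U y)

    #used-insert : ∀ U x → x < n → U x ≡ false → #used (insert U x) ≡ suc (#used U)
    #used-insert U x x<n Ux≡false = trans (count<-insert n (λ _ → true) U x x<n Ux≡false) (+-comm (#used U) 1)

    #used-beyond-insert : ∀ U x → x < n → U x ≡ false → #used-beyond (insert U x) ≡ #used-beyond U + 𝟙 (N ≤ᵇ x)
    #used-beyond-insert U x = count<-insert n (N ≤ᵇ_) U x

    #unused : ∀ U → count< n (not ∘ U) ≡ n ∸ #used U
    #unused U = trans (sym (m+n∸n≡m _ (#used U)))
                      (cong (_∸ #used U) (trans (count<-complement n (λ _ → true) U) (count<-≥ n 0)))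

    #unused-beyond : ∀ U → count< n (λ y → (N ≤ᵇ y) ∧ not (U y)) ≡ n ∸ N ∸ #used-beyond U
    #unused-beyond U = trans (sym (m+n∸n≡m _ (#used-beyond U)))
                             (cong (_∸ #used-beyond U) (trans (count<-complement n (N ≤ᵇ_) U) (count<-≥ n N)))

    arrangements-free-ub : ∀ k τ u a a′ → (∀ i → τ i ≡ free) → arrangements τ k u a ≡ arrangements τ k u a′
    arrangements-free-ub k τ u a a′ all-free =
      trans (arrangements-free k τ u a all-free) (sym (arrangements-free k τ u a′ all-free))

    mutual
      #admissible≡arrangements : ∀ k τ U → Consistent τ U → #admissible τ U k ≡ arrangements τ k (#used U) (#used-beyond U)
      #admissible≡arrangements zero    τ U c = refl
      #admissible≡arrangements (suc k) τ U c = #admissible-suc≡ k τ U c (τ 0) refl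

      #admissible-suc≡ : ∀ k τ U → Consistent τ U → ∀ t → τ 0 ≡ t →
                         #admissible τ U (suc k) ≡ arrangements-at t (τ ∘ suc) k (#used U) (#used-beyond U)
      #admissible-suc≡ k τ U c (at j) τ0≡at = begin
        #admissible τ U (suc k)                    ≡⟨ #admissible-suc τ U k (at j) τ0≡at ⟩
        sum< n f                                   ≡⟨ sum<-point n f j j<n f≡0 ⟩
        f j                                        ≡⟨ fj≡ ⟩
        #admissible (τ ∘ suc) (insert U j) k       ≡⟨ #admissible≡arrangements k (τ ∘ suc) (insert U j) (consistent-at c τ0≡at) ⟩
        arrangements (τ ∘ suc) k (#used (insert U j)) (#used-beyond (insert U j))
          ≡⟨ cong₂ (arrangements (τ ∘ suc) k) (#used-insert U j j<n Uj≡false) #used-beyond≡ ⟩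
        arrangements (τ ∘ suc) k (suc (#used U)) (#used-beyond U) ∎
        where
        open ≡-Reasoning
        A = λ y → #admissible (τ ∘ suc) (insert U y) k
        f = λ y → if y ≡ᵇ j then (if not (U y) then A y else 0) else 0
        j<N = at<N c 0 j τ0≡at
        j<n = <-≤-trans j<N N≤n
        Uj≡false = at-unused c 0 j τ0≡at
        f≡0 : ∀ y → y < n → y ≢ j → f y ≡ 0
        f≡0 y _ y≢j = cong (λ b → if b then (if not (U y) then A y else 0) else 0) (≢⇒≡ᵇ-false y j y≢j)
        fj≡ : f j ≡ A j
        fj≡ = trans (cong (λ b → if b then (if not (U j) then A j else 0) else 0) (≡ᵇ-refl j))
                    (cong (λ b → if not b then A j else 0) Uj≡false)
        #used-beyond≡ : #used-beyond (insert U j) ≡ #used-beyond U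
        #used-beyond≡ = trans (#used-beyond-insert U j j<n Uj≡false)
          (trans (cong (λ b → #used-beyond U + 𝟙 b) (dec-false (N ≤? j) (<⇒≱ j<N))) (+-identityʳ (#used-beyond U)))
      #admissible-suc≡ k τ U c beyond τ0≡beyond = begin
        #admissible τ U (suc k)                                 ≡⟨ #admissible-suc τ U k beyond τ0≡beyond ⟩
        sum< n f                                                ≡⟨ sum<-cong n f≡ ⟩
        sum< n (λ y → if (N ≤ᵇ y) ∧ not (U y) then V else 0)    ≡⟨ sum<-if n _ V ⟩
        V * count< n (λ y → (N ≤ᵇ y) ∧ not (U y))               ≡⟨ cong (V *_) (#unused-beyond U) ⟩
        V * (n ∸ N ∸ #used-beyond U)                            ≡⟨ *-comm V _ ⟩
        (n ∸ N ∸ #used-beyond U) * V                            ∎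
        where
        open ≡-Reasoning
        A = λ y → #admissible (τ ∘ suc) (insert U y) k
        f = λ y → if N ≤ᵇ y then (if not (U y) then A y else 0) else 0
        V = arrangements (τ ∘ suc) k (suc (#used U)) (suc (#used-beyond U))
        f≡ : ∀ y → y < n → f y ≡ (if (N ≤ᵇ y) ∧ not (U y) then V else 0)
        f≡ y y<n with N ≤ᵇ y in N≤ᵇy
        ... | false = refl
        ... | true with U y in Uy
        ...   | true  = refl
        ...   | false = trans
          (#admissible≡arrangements k (τ ∘ suc) (insert U y) (consistent-beyond c (≤ᵇ⇒≤ N y (subst Data.Bool.T (sym N≤ᵇy) _))))
          (cong₂ (arrangements (τ ∘ suc) k) (#used-insert U y y<n Uy)
                 (trans (#used-beyond-insert U y y<n Uy) (trans (cong (λ b → #used-beyond U + 𝟙 b) N≤ᵇy) (+-comm (#used-beyond U) 1))))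
          where import Data.Bool
      #admissible-suc≡ k τ U c free τ0≡free = begin
        #admissible τ U (suc k)                   ≡⟨ #admissible-suc τ U k free τ0≡free ⟩
        sum< n f                                  ≡⟨ sum<-cong n f≡ ⟩
        sum< n (λ y → if not (U y) then V else 0) ≡⟨ sum<-if n _ V ⟩
        V * count< n (not ∘ U)                    ≡⟨ cong (V *_) (#unused U) ⟩
        V * (n ∸ #used U)                         ≡⟨ *-comm V _ ⟩
        (n ∸ #used U) * V                         ∎
        where
        open ≡-Reasoning
        A = λ y → #admissible (τ ∘ suc) (insert U y) k
        f = λ y → if true then (if not (U y) then A y else 0) else 0
        V = arrangements (τ ∘ suc) k (suc (#used U)) (#used-beyond U)
        f≡ : ∀ y → y < n → f y ≡ (if not (U y) then V else 0)
        f≡ y y<n with U y in Uy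
        ... | true  = refl
        ... | false = trans (#admissible≡arrangements k (τ ∘ suc) (insert U y) (consistent-free c τ0≡free))
          (trans (cong (λ u → arrangements (τ ∘ suc) k u (#used-beyond (insert U y))) (#used-insert U y y<n Uy))
                 (arrangements-free-ub k (τ ∘ suc) (suc (#used U)) _ _ (all-free c τ0≡free ∘ suc)))

    mutual
      arrangements-split : ∀ a r τ u ub → (∀ i → i < a → τ i ≢ free) → (∀ i → a ≤ i → τ i ≡ free) →
        arrangements τ (a + r) u ub ≡ (n ∸ N ∸ ub) ↓ sum< a (isBeyond ∘ τ) * (n ∸ (u + a)) ↓ r
      arrangements-split zero    r τ u ub _        free-from = trans (arrangements-free r τ u ub (λ i → free-from i z≤n))
        (sym (trans (*-identityˡ _) (cong (λ t → (n ∸ t) ↓ r) (+-identityʳ u))))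
      arrangements-split (suc a) r τ u ub not-free free-from = arrangements-at-split a r τ u ub not-free free-from (τ 0) refl

      arrangements-at-split : ∀ a r τ u ub → (∀ i → i < suc a → τ i ≢ free) → (∀ i → suc a ≤ i → τ i ≡ free) →
        ∀ t → τ 0 ≡ t → arrangements-at t (τ ∘ suc) (a + r) u ub
                        ≡ (n ∸ N ∸ ub) ↓ (isBeyond t + sum< a (isBeyond ∘ τ ∘ suc)) * (n ∸ (u + suc a)) ↓ r
      arrangements-at-split a r τ u ub not-free free-from (at j) _ = trans
        (arrangements-split a r (τ ∘ suc) (suc u) ub (λ i i<a → not-free (suc i) (s<s i<a)) (λ i a≤i → free-from (suc i) (s≤s a≤i)))
        (cong (λ t → (n ∸ N ∸ ub) ↓ sum< a (isBeyond ∘ τ ∘ suc) * (n ∸ t) ↓ r) (sym (+-suc u a)))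
      arrangements-at-split a r τ u ub not-free free-from beyond _ = begin
        (n ∸ N ∸ ub) * arrangements (τ ∘ suc) (a + r) (suc u) (suc ub)
          ≡⟨ cong ((n ∸ N ∸ ub) *_) (arrangements-split a r (τ ∘ suc) (suc u) (suc ub)
                                       (λ i i<a → not-free (suc i) (s<s i<a)) (λ i a≤i → free-from (suc i) (s≤s a≤i))) ⟩
        (n ∸ N ∸ ub) * ((n ∸ N ∸ suc ub) ↓ b * (n ∸ (suc u + a)) ↓ r)
          ≡⟨ cong₂ (λ p q → (n ∸ N ∸ ub) * (p ↓ b * (n ∸ q) ↓ r)) (sym (pred[m∸n]≡m∸[1+n] (n ∸ N) ub)) (sym (+-suc u a)) ⟩
        (n ∸ N ∸ ub) * ((n ∸ N ∸ ub ∸ 1) ↓ b * (n ∸ (u + suc a)) ↓ r)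
          ≡⟨ *-assoc (n ∸ N ∸ ub) _ _ ⟨
        (n ∸ N ∸ ub) ↓ suc b * (n ∸ (u + suc a)) ↓ r ∎
        where
        open ≡-Reasoning
        b = sum< a (isBeyond ∘ τ ∘ suc)
      arrangements-at-split a r τ u ub not-free free-from free τ0≡free = contradiction τ0≡free (not-free 0 z<s)

    notIn : ∀ {k} → ℕ → Vec (Fin n) k → Bool
    notIn y []      = true
    notIn y (z ∷ v) = not (y ≡ᵇ toℕ z) ∧ notIn y v

    distinct : ∀ {k} → Vec (Fin n) k → Bool
    distinct []      = true
    distinct (x ∷ v) = notIn (toℕ x) v ∧ distinct v

    avoids : ∀ {k} → (ℕ → Bool) → Vec (Fin n) k → Bool
    avoids U []      = true
    avoids U (x ∷ v) = not (U (toℕ x)) ∧ avoids U v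

    fitsAll : ∀ {k} → (ℕ → Slot) → Vec (Fin n) k → Bool
    fitsAll τ []      = true
    fitsAll τ (x ∷ v) = fits (τ 0) (toℕ x) ∧ fitsAll (τ ∘ suc) v

    unique?≡distinct : ∀ {k} (v : Vec (Fin n) k) → does (unique? (Vec.toList v)) ≡ distinct v
    unique?≡distinct []      = refl
    unique?≡distinct (x ∷ v) = cong₂ _∧_ (all-≢≡notIn v) (unique?≡distinct v)
      where
      all-≢≡notIn : ∀ {k} (v : Vec (Fin n) k) → does (All.all? (λ y → ¬? (x Fin.≟ y)) (Vec.toList v)) ≡ notIn (toℕ x) v
      all-≢≡notIn []      = refl
      all-≢≡notIn (y ∷ v) = cong₂ _∧_ (cong not (does-Fin-≟ x y)) (all-≢≡notIn v)

    avoids-insert : ∀ {k} U y (v : Vec (Fin n) k) → avoids (insert U y) v ≡ avoids U v ∧ notIn y v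
    avoids-insert U y []      = refl
    avoids-insert U y (z ∷ v) = begin
      not (U (toℕ z) ∨ (toℕ z ≡ᵇ y)) ∧ avoids (insert U y) v
        ≡⟨ cong₂ (λ a c → not (U (toℕ z) ∨ a) ∧ c) (≡ᵇ-sym (toℕ z) y) (avoids-insert U y v) ⟩
      not (U (toℕ z) ∨ (y ≡ᵇ toℕ z)) ∧ (avoids U v ∧ notIn y v)
        ≡⟨ regroup (U (toℕ z)) (y ≡ᵇ toℕ z) (avoids U v) (notIn y v) ⟩
      (not (U (toℕ z)) ∧ avoids U v) ∧ (not (y ≡ᵇ toℕ z) ∧ notIn y v) ∎
      where
      open ≡-Reasoning
      regroup : ∀ a b c d → not (a ∨ b) ∧ (c ∧ d) ≡ (not a ∧ c) ∧ (not b ∧ d)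
      regroup true  b     c d = refl
      regroup false true  c d = sym (Bool.∧-zeroʳ c)
      regroup false false c d = refl

    avoids-∅ : ∀ {k} (v : Vec (Fin n) k) → avoids (λ _ → false) v ≡ true
    avoids-∅ []      = refl
    avoids-∅ (x ∷ v) = avoids-∅ v

    admissible≡ : ∀ {k} τ U (v : Vec (Fin n) k) → Admissible τ U v ≡ distinct v ∧ (avoids U v ∧ fitsAll τ v)
    admissible≡ τ U []      = refl
    admissible≡ τ U (x ∷ v) = begin
      fits (τ 0) y ∧ (not (U y) ∧ Admissible (τ ∘ suc) (insert U y) v)
        ≡⟨ cong (λ t → fits (τ 0) y ∧ (not (U y) ∧ t)) (admissible≡ (τ ∘ suc) (insert U y) v) ⟩
      fits (τ 0) y ∧ (not (U y) ∧ (distinct v ∧ (avoids (insert U y) v ∧ fitsAll (τ ∘ suc) v)))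
        ≡⟨ cong (λ t → fits (τ 0) y ∧ (not (U y) ∧ (distinct v ∧ (t ∧ fitsAll (τ ∘ suc) v)))) (avoids-insert U y v) ⟩
      fits (τ 0) y ∧ (not (U y) ∧ (distinct v ∧ ((avoids U v ∧ notIn y v) ∧ fitsAll (τ ∘ suc) v)))
        ≡⟨ regroup (fits (τ 0) y) (not (U y)) (distinct v) (avoids U v) (notIn y v) (fitsAll (τ ∘ suc) v) ⟩
      (notIn y v ∧ distinct v) ∧ ((not (U y) ∧ avoids U v) ∧ (fits (τ 0) y ∧ fitsAll (τ ∘ suc) v)) ∎
      where
      open ≡-Reasoning
      open ∨-∧-Solver
      y = toℕ x
      regroup : ∀ s u d a i t → s ∧ (u ∧ (d ∧ ((a ∧ i) ∧ t))) ≡ (i ∧ d) ∧ ((u ∧ a) ∧ (s ∧ t))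
      regroup = solve 6 (λ s u d a i t → s :* (u :* (d :* ((a :* i) :* t))) := (i :* d) :* ((u :* a) :* (s :* t))) refl

    count-Sn : ∀ τ (f : Vec (Fin n) n → Bool) → (∀ σ → f σ ≡ fitsAll τ σ) → Consistent τ (λ _ → false) →
               count f (Sn n) ≡ arrangements τ n 0 0
    count-Sn τ f f≗fitsAll c = begin
      count f (Sn n)
        ≡⟨ count-filter (λ v → unique? (Vec.toList v)) f (allVecs n n) ⟩
      count (λ v → does (unique? (Vec.toList v)) ∧ f v) (allVecs n n)
        ≡⟨ count-cong (λ v → trans (cong₂ _∧_ (unique?≡distinct v) (f≗fitsAll v)) (sym (admissible-∅ v))) (allVecs n n) ⟩
      #admissible τ (λ _ → false) n
        ≡⟨ #admissible≡arrangements n τ (λ _ → false) c ⟩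
      arrangements τ n (#used (λ _ → false)) (#used-beyond (λ _ → false))
        ≡⟨ cong₂ (arrangements τ n) (none n) (trans (sum<-cong n (λ y _ → cong 𝟙 (Bool.∧-zeroʳ (N ≤ᵇ y)))) (none n)) ⟩
      arrangements τ n 0 0 ∎
      where
      open ≡-Reasoning
      admissible-∅ : ∀ v → Admissible τ (λ _ → false) v ≡ distinct v ∧ fitsAll τ v
      admissible-∅ v = trans (admissible≡ τ (λ _ → false) v) (cong (λ t → distinct v ∧ (t ∧ fitsAll τ v)) (avoids-∅ v))
      none : ∀ m → count< m (λ _ → false) ≡ 0
      none zero    = refl
      none (suc m) = none m

    length-Sn : length (Sn n) ≡ n ↓ n
    length-Sn = begin
      length (Sn n)                        ≡⟨ length≡count (Sn n) ⟩
      count (λ _ → true) (Sn n)            ≡⟨ count-Sn (λ _ → free) (λ _ → true) (sym ∘ fitsAll-free) all-free-consistent ⟩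
      arrangements (λ _ → free) n 0 0      ≡⟨ arrangements-free n (λ _ → free) 0 0 (λ _ → refl) ⟩
      n ↓ n                                ∎
      where
      open ≡-Reasoning
      length≡count : ∀ {A : Set} (xs : List A) → length xs ≡ count (λ _ → true) xs
      length≡count []       = refl
      length≡count (x ∷ xs) = cong suc (length≡count xs)
      fitsAll-free : ∀ {k} (v : Vec (Fin n) k) → fitsAll (λ _ → free) v ≡ true
      fitsAll-free []      = refl
      fitsAll-free (x ∷ v) = fitsAll-free v
      all-free-consistent : Consistent (λ _ → free) (λ _ → false)
      all-free-consistent = record { at<N = λ _ _ () ; at-injective = λ _ _ _ () ; at-unused = λ _ _ () ; free-suc = λ _ _ → refl }

  boolEq-true : ∀ x → boolEq x true ≡ x
  boolEq-true true  = refl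
  boolEq-true false = refl

  boolEq-false : ∀ x → boolEq x false ≡ not x
  boolEq-false true  = refl
  boolEq-false false = refl

  and-++ : ∀ xs ys → and (xs ++ ys) ≡ and xs ∧ and ys
  and-++ []       ys = refl
  and-++ (x ∷ xs) ys = trans (cong (x ∧_) (and-++ xs ys)) (sym (Bool.∧-assoc x (and xs) (and ys)))

  and-concat : ∀ {N} (F : Fin N → List Bool) → and (concat (tabulate F)) ≡ and (tabulate (and ∘ F))
  and-concat {zero}  F = refl
  and-concat {suc N} F = trans (and-++ (F Fin.zero) _) (cong (and (F Fin.zero) ∧_) (and-concat (F ∘ Fin.suc)))

  and-tabulate⁻ : ∀ {N} (g : Fin N → Bool) → and (tabulate g) ≡ true → ∀ i → g i ≡ true
  and-tabulate⁻ {suc N} g all Fin.zero    = Bool.∧-conicalˡ _ _ all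
  and-tabulate⁻ {suc N} g all (Fin.suc i) = and-tabulate⁻ (g ∘ Fin.suc) (Bool.∧-conicalʳ _ _ all) i

  and-tabulate⁺ : ∀ {N} (g : Fin N → Bool) → (∀ i → g i ≡ true) → and (tabulate g) ≡ true
  and-tabulate⁺ {zero}  g all = refl
  and-tabulate⁺ {suc N} g all = cong₂ _∧_ (all Fin.zero) (and-tabulate⁺ (g ∘ Fin.suc) (all ∘ Fin.suc))

  bool-ext : ∀ a c → (a ≡ true → c ≡ true) → (c ≡ true → a ≡ true) → a ≡ c
  bool-ext true  c     a⇒c c⇒a = sym (a⇒c refl)
  bool-ext false true  a⇒c c⇒a = c⇒a refl
  bool-ext false false a⇒c c⇒a = refl

  map-allFin : ∀ {A : Set} N (g : Fin N → A) → map g (allFin N) ≡ tabulate g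
  map-allFin N g = List.map-tabulate {n = N} id g

  sum-𝟙-none : ∀ {N} (f : Fin N → Bool) → (∀ c → f c ≡ false) → sum (tabulate (𝟙 ∘ f)) ≡ 0
  sum-𝟙-none {zero}  f none = refl
  sum-𝟙-none {suc N} f none = trans (cong (λ t → 𝟙 t + sum (tabulate (𝟙 ∘ f ∘ Fin.suc))) (none Fin.zero)) (sum-𝟙-none (f ∘ Fin.suc) (none ∘ Fin.suc))

  sum-𝟙-unique : ∀ {N} (f : Fin N → Bool) c → f c ≡ true → (∀ c′ → f c′ ≡ true → c′ ≡ c) → sum (tabulate (𝟙 ∘ f)) ≡ 1
  sum-𝟙-unique {suc N} f Fin.zero    fc unique = trans (cong (λ t → 𝟙 t + sum (tabulate (𝟙 ∘ f ∘ Fin.suc))) fc)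
    (cong suc (sum-𝟙-none (f ∘ Fin.suc) λ c′ → Bool.¬-not λ fc′ → contradiction (unique (Fin.suc c′) fc′) λ ()))
  sum-𝟙-unique {suc N} f (Fin.suc c) fc unique = trans
    (cong (λ t → 𝟙 t + sum (tabulate (𝟙 ∘ f ∘ Fin.suc))) (Bool.¬-not λ f0 → contradiction (unique Fin.zero f0) λ ()))
    (sum-𝟙-unique (f ∘ Fin.suc) c fc (λ c′ fc′ → Fin.suc-injective (unique (Fin.suc c′) fc′)))

  -- The number of columns is suc b because Defs.permEntry is constantly false when n = 0.
  module Pattern (b N : ℕ) (N≤n : N ≤ suc b) (M : Mat N)
                 (row≤1 : ∀ i j j′ → M i j ≡ true → M i j′ ≡ true → j ≡ j′)
                 (col≤1 : ∀ i i′ j → M i j ≡ true → M i′ j ≡ true → i ≡ i′) where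

    open Counting (suc b) N N≤n

    data RowView (r : Fin N) : Set where
      one   : ∀ c → M r c ≡ true → RowView r
      empty : (∀ c → M r c ≡ false) → RowView r

    rowView : ∀ r → RowView r
    rowView r with Fin.any? (λ c → M r c Bool.≟ true)
    ... | yes (c , Mrc) = one c Mrc
    ... | no  ∄c        = empty (λ c → Bool.¬-not (λ Mrc → ∄c (c , Mrc)))

    slotOf : ∀ {r} → RowView r → Slot
    slotOf (one c _) = at (toℕ c)
    slotOf (empty _) = beyond

    τ : ℕ → Slot
    τ i with i <? N
    ... | yes i<N = slotOf (rowView (fromℕ< i<N))
    ... | no  _   = free

    τ-toℕ : ∀ r → τ (toℕ r) ≡ slotOf (rowView r)
    τ-toℕ r with toℕ r <? N
    ... | yes r<N = cong (slotOf ∘ rowView) (Fin.fromℕ<-toℕ r r<N)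
    ... | no  r≮N = contradiction (Fin.toℕ<n r) r≮N

    τ-≥ : ∀ i → N ≤ i → τ i ≡ free
    τ-≥ i N≤i with i <? N
    ... | yes i<N = contradiction N≤i (<⇒≱ i<N)
    ... | no  _   = refl

    τ-< : ∀ i (i<N : i < N) → τ i ≡ slotOf (rowView (fromℕ< i<N))
    τ-< i i<N = trans (cong τ (sym (Fin.toℕ-fromℕ< i<N))) (τ-toℕ (fromℕ< i<N))

    slotOf≢free : ∀ {r} (v : RowView r) → slotOf v ≢ free
    slotOf≢free (one _ _) ()
    slotOf≢free (empty _) ()

    τ≢free : ∀ i → i < N → τ i ≢ free
    τ≢free i i<N = slotOf≢free (rowView (fromℕ< i<N)) ∘ trans (sym (τ-< i i<N))

    OneAt : ℕ → ℕ → Set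
    OneAt i j = Σ (Fin N) λ r → Σ (Fin N) λ c → toℕ r ≡ i × toℕ c ≡ j × M r c ≡ true

    τ-at : ∀ i j → τ i ≡ at j → OneAt i j
    τ-at i j τi≡at with i <? N
    ... | no  _   = contradiction τi≡at λ ()
    ... | yes i<N = slotOf-at (rowView (fromℕ< i<N)) τi≡at
      where
      slotOf-at : (v : RowView (fromℕ< i<N)) → slotOf v ≡ at j → OneAt i j
      slotOf-at (one c Mrc) refl = fromℕ< i<N , c , Fin.toℕ-fromℕ< i<N , refl , Mrc

    consistent : Consistent τ (λ _ → false)
    consistent = record
      { at<N         = λ i j τi≡at → let (_ , c , _ , c≡j , _) = τ-at i j τi≡at in subst (_< N) c≡j (Fin.toℕ<n c)
      ; at-injective = λ i i′ j p q → same-row (τ-at i j p) (τ-at i′ j q)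
      ; at-unused    = λ _ _ _ → refl
      ; free-suc     = λ i τi≡free → τ-≥ (suc i) (m≤n⇒m≤1+n (≥N i τi≡free)) }
      where
      same-row : ∀ {i i′ j} → OneAt i j → OneAt i′ j → i ≡ i′
      same-row (r , c , refl , c≡j , Mrc) (r′ , c′ , refl , c′≡j , Mr′c′)
        with refl ← Fin.toℕ-injective (trans c≡j (sym c′≡j)) = cong toℕ (col≤1 r r′ c Mrc Mr′c′)
      ≥N : ∀ i → τ i ≡ free → N ≤ i
      ≥N i τi≡free = ≮⇒≥ (λ i<N → τ≢free i i<N τi≡free)

    agrees⇒fits : ∀ r y → (∀ j → boolEq (y ≡ᵇ toℕ j) (M r j) ≡ true) → fits (slotOf (rowView r)) y ≡ true
    agrees⇒fits r y agree = go (rowView r)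
      where
      go : (v : RowView r) → fits (slotOf v) y ≡ true
      go (one c Mrc)  = trans (sym (boolEq-true _)) (subst (λ t → boolEq (y ≡ᵇ toℕ c) t ≡ true) Mrc (agree c))
      go (empty none) with y <? N
      ... | no  y≮N = dec-true (N ≤? y) (≮⇒≥ y≮N)
      ... | yes y<N = contradiction
        (trans (sym (cong₂ boolEq (trans (cong (y ≡ᵇ_) (Fin.toℕ-fromℕ< y<N)) (≡ᵇ-refl y)) (none (fromℕ< y<N))))
               (agree (fromℕ< y<N)))
        λ ()

    fits⇒agrees : ∀ r y → fits (slotOf (rowView r)) y ≡ true → ∀ j → boolEq (y ≡ᵇ toℕ j) (M r j) ≡ true
    fits⇒agrees r y = go (rowView r)
      where
      go : (v : RowView r) → fits (slotOf v) y ≡ true → ∀ j → boolEq (y ≡ᵇ toℕ j) (M r j) ≡ true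
      go (one c Mrc) y≡ᵇc j with ≡ᵇ-true⇒≡ y (toℕ c) y≡ᵇc | M r j in Mrj
      ... | refl | true  rewrite row≤1 r j c Mrj Mrc = trans (boolEq-true _) (≡ᵇ-refl (toℕ c))
      ... | refl | false = trans (boolEq-false _) (cong not (≢⇒≡ᵇ-false (toℕ c) (toℕ j) λ c≡j →
                             contradiction (trans (sym Mrj) (subst (λ t → M r t ≡ true) (Fin.toℕ-injective c≡j) Mrc)) λ ()))
      go (empty none) N≤ᵇy j = cong₂ boolEq (≢⇒≡ᵇ-false y (toℕ j) y≢j) (none j)
        where
        y≢j : y ≢ toℕ j
        y≢j refl = <⇒≱ (Fin.toℕ<n j) (≤ᵇ⇒≤ N y (subst T (sym N≤ᵇy) _))

    fitsAll⇒lookup : ∀ {k} τ′ (v : Vec (Fin (suc b)) k) → fitsAll τ′ v ≡ true →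
                     ∀ i → i < k → fits (τ′ i) (toℕ (lookupℕ v i Fin.zero)) ≡ true
    fitsAll⇒lookup τ′ (x ∷ v) all zero    _         = Bool.∧-conicalˡ _ _ all
    fitsAll⇒lookup τ′ (x ∷ v) all (suc i) (s<s i<k) = fitsAll⇒lookup (τ′ ∘ suc) v (Bool.∧-conicalʳ _ _ all) i i<k

    lookup⇒fitsAll : ∀ {k} τ′ (v : Vec (Fin (suc b)) k) →
                     (∀ i → i < k → fits (τ′ i) (toℕ (lookupℕ v i Fin.zero)) ≡ true) → fitsAll τ′ v ≡ true
    lookup⇒fitsAll τ′ []      each = refl
    lookup⇒fitsAll τ′ (x ∷ v) each = cong₂ _∧_ (each 0 z<s) (lookup⇒fitsAll (τ′ ∘ suc) v (λ i i<k → each (suc i) (s<s i<k)))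

    topLeftIs≡fitsAll : ∀ σ → topLeftIs σ M ≡ fitsAll τ σ
    topLeftIs≡fitsAll σ = bool-ext _ _ agree⇒fit fit⇒agree
      where
      σ′ : Fin N → ℕ
      σ′ r = toℕ (lookupℕ σ (toℕ r) Fin.zero)
      agreement : Fin N → Fin N → Bool
      agreement r j = boolEq (σ′ r ≡ᵇ toℕ j) (M r j)
      topLeftIs≡ : topLeftIs σ M ≡ and (tabulate (λ r → and (tabulate (agreement r))))
      topLeftIs≡ = trans (cong and (cong concat (map-allFin N (λ i → map (agreement i) (allFin N)))))
        (trans (and-concat (λ i → map (agreement i) (allFin N)))
               (cong and (List.tabulate-cong (λ r → cong and (map-allFin N (agreement r))))))
      agree⇒fit : topLeftIs σ M ≡ true → fitsAll τ σ ≡ true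
      agree⇒fit agrees = lookup⇒fitsAll τ σ (λ i _ → fits-at i)
        where
        row-fits : ∀ r → fits (slotOf (rowView r)) (σ′ r) ≡ true
        row-fits r = agrees⇒fits r (σ′ r)
          (and-tabulate⁻ (agreement r) (and-tabulate⁻ (λ r → and (tabulate (agreement r))) (trans (sym topLeftIs≡) agrees) r))
        fits-at : ∀ i → fits (τ i) (toℕ (lookupℕ σ i Fin.zero)) ≡ true
        fits-at i with i <? N
        ... | no  _   = refl
        ... | yes i<N = subst (λ t → fits (slotOf (rowView (fromℕ< i<N))) (toℕ (lookupℕ σ t Fin.zero)) ≡ true)
                              (Fin.toℕ-fromℕ< i<N) (row-fits (fromℕ< i<N))
      fit⇒agree : fitsAll τ σ ≡ true → topLeftIs σ M ≡ true
      fit⇒agree fit = trans topLeftIs≡ (and-tabulate⁺ _ (λ r → and-tabulate⁺ (agreement r) (fits⇒agrees r (σ′ r)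
        (subst (λ t → fits t (σ′ r) ≡ true) (τ-toℕ r) (fitsAll⇒lookup τ σ fit (toℕ r) (<-≤-trans (Fin.toℕ<n r) N≤n))))))

    #empty-rows : ℕ
    #empty-rows = sum< N (isBeyond ∘ τ)

    length-matching : length (filter (λ σ → topLeftIs σ M Bool.≟ true) (Sn (suc b)))
                      ≡ (suc b ∸ N) ↓ #empty-rows * (suc b ∸ N) ↓ (suc b ∸ N)
    length-matching = begin
      length (filter (λ σ → topLeftIs σ M Bool.≟ true) (Sn n))
        ≡⟨ length-filter≡count (λ σ → topLeftIs σ M Bool.≟ true) (Sn n) ⟩
      count (λ σ → does (topLeftIs σ M Bool.≟ true)) (Sn n)
        ≡⟨ count-Sn τ _ (λ σ → trans (does-≟-true (topLeftIs σ M)) (topLeftIs≡fitsAll σ)) consistent ⟩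
      arrangements τ n 0 0
        ≡⟨ cong (λ k → arrangements τ k 0 0) (m+[n∸m]≡n N≤n) ⟨
      arrangements τ (N + (n ∸ N)) 0 0
        ≡⟨ arrangements-split N (n ∸ N) τ 0 0 τ≢free τ-≥ ⟩
      (n ∸ N) ↓ #empty-rows * (n ∸ N) ↓ (n ∸ N) ∎
      where
      open ≡-Reasoning
      n = suc b
      does-≟-true : ∀ c → does (c Bool.≟ true) ≡ c
      does-≟-true true  = refl
      does-≟-true false = refl

    ones+#empty-rows≡N : ones M + #empty-rows ≡ N
    ones+#empty-rows≡N = begin
      ones M + #empty-rows                                 ≡⟨ cong (_+ #empty-rows) ones≡ ⟩
      sum< N (isAt ∘ τ) + sum< N (isBeyond ∘ τ)           ≡⟨ sum<-+ N _ _ ⟩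
      sum< N (λ i → isAt (τ i) + isBeyond (τ i))          ≡⟨ sum<-cong N one-each ⟩
      sum< N (λ _ → 1)                                     ≡⟨ sum<-const N ⟩
      N                                                    ∎
      where
      open ≡-Reasoning
      isAt : Slot → ℕ
      isAt (at _) = 1
      isAt beyond = 0
      isAt free   = 0
      sum-concatMap : ∀ {A : Set} (f : A → List ℕ) xs → sum (concatMap f xs) ≡ sum (map (sum ∘ f) xs)
      sum-concatMap f []       = refl
      sum-concatMap f (x ∷ xs) = trans (sum-++ (f x) (concatMap f xs)) (cong (sum (f x) +_) (sum-concatMap f xs))
      row-sum : ∀ r → sum (map (λ j → 𝟙 (M r j)) (allFin N)) ≡ isAt (τ (toℕ r))
      row-sum r = trans (cong sum (map-allFin N (λ j → 𝟙 (M r j)))) (trans (go (rowView r)) (cong isAt (sym (τ-toℕ r))))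
        where
        go : (v : RowView r) → sum (tabulate (λ j → 𝟙 (M r j))) ≡ isAt (slotOf v)
        go (one c Mrc)  = sum-𝟙-unique (M r) c Mrc (λ c′ Mrc′ → row≤1 r c′ c Mrc′ Mrc)
        go (empty none) = sum-𝟙-none (M r) none
      ones≡ : ones M ≡ sum< N (isAt ∘ τ)
      ones≡ = trans (sum-concatMap (λ i → map (λ j → 𝟙 (M i j)) (allFin N)) (allFin N))
                    (trans (cong sum (List.map-cong row-sum (allFin N))) (sum-allFin≡sum< N (isAt ∘ τ)))
      one-each : ∀ i → i < N → isAt (τ i) + isBeyond (τ i) ≡ 1
      one-each i i<N with τ i in τi
      ... | at _   = refl
      ... | beyond = refl
      ... | free   = contradiction τi (τ≢free i i<N)

module _ where

  open import Data.Nat as ℕ using (ℕ; suc; _^_; _∸_; s≤s; z≤n)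
  import Data.Nat.Properties as ℕ
  open import Data.Nat.Tactic.RingSolver using (solve-∀)
  open import Data.Nat.ListAction using (sum)
  open import Algebra.Properties.CommutativeSemigroup ℕ.*-commutativeSemigroup using (xy∙z≈xz∙y)
  open import Data.Integer as ℤ using (+_; +[1+_])
  import Data.Integer.Properties as ℤ
  open import Data.Rational using (ℚ; mkℚ; 1ℚ; _÷_; _+_; _*_; _-_; -_; ∣_∣; _≤_; 1/_; ↧ₙ_; Positive; NonZero; toℚᵘ)
  open import Data.Rational.Properties
  open import Data.Rational.Unnormalised as ℚᵘ using (mkℚᵘ; *≡*; *≤*)
  import Data.Rational.Unnormalised.Properties as ℚᵘ
  open import Data.Rational.Solver using (module +-*-Solver)
  open import Data.Bool using (Bool; true; false; if_then_else_)
  open import Data.List using (List; []; _∷_; map; concatMap; length; allFin; foldr)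
  import Data.List.Properties as List
  open import Data.Product using (_,_)
  open import Data.Sum using (inj₁; inj₂)
  open import Function using (id)
  open import Relation.Binary.PropositionalEquality
  open import Relation.Nullary using (yes; no)

  toℚᵘ-divℕ : ∀ a b → toℚᵘ (divℕ a (suc b)) ℚᵘ.≃ mkℚᵘ (+ a) b
  toℚᵘ-divℕ a b = toℚᵘ-fromℚᵘ (mkℚᵘ (+ a) b)

  divℕ-cong : ∀ a b c e → a ℕ.* suc e ≡ c ℕ.* suc b → divℕ a (suc b) ≡ divℕ c (suc e)
  divℕ-cong a b c e eq = fromℚᵘ-cong {mkℚᵘ (+ a) b} {mkℚᵘ (+ c) e} (*≡* (trans (sym (ℤ.pos-* a (suc e))) (trans (cong +_ eq) (ℤ.pos-* c (suc b)))))

  divℕ-* : ∀ a B c E → 0 ℕ.< B → 0 ℕ.< E → divℕ a B * divℕ c E ≡ divℕ (a ℕ.* c) (B ℕ.* E)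
  divℕ-* a (suc b) c (suc e) _ _ = toℚᵘ-injective (begin
    toℚᵘ (divℕ a (suc b) * divℕ c (suc e))               ≈⟨ toℚᵘ-homo-* (divℕ a (suc b)) (divℕ c (suc e)) ⟩
    toℚᵘ (divℕ a (suc b)) ℚᵘ.* toℚᵘ (divℕ c (suc e))     ≈⟨ ℚᵘ.*-cong (toℚᵘ-divℕ a b) (toℚᵘ-divℕ c e) ⟩
    mkℚᵘ (+ a) b ℚᵘ.* mkℚᵘ (+ c) e                       ≈⟨ ℚᵘ.≃-reflexive (cong (λ z → mkℚᵘ z _) (sym (ℤ.pos-* a c))) ⟩
    mkℚᵘ (+ (a ℕ.* c)) (ℕ.pred (suc b ℕ.* suc e))         ≈⟨ toℚᵘ-divℕ (a ℕ.* c) _ ⟨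
    toℚᵘ (divℕ (a ℕ.* c) (suc b ℕ.* suc e))              ∎)
    where open import Relation.Binary.Reasoning.Setoid ℚᵘ.≃-setoid

  divℕ-+ : ∀ a b c e → divℕ a (suc b) + divℕ c (suc e) ≡ divℕ (a ℕ.* suc e ℕ.+ c ℕ.* suc b) (suc b ℕ.* suc e)
  divℕ-+ a b c e = toℚᵘ-injective (begin
    toℚᵘ (divℕ a (suc b) + divℕ c (suc e))               ≈⟨ toℚᵘ-homo-+ (divℕ a (suc b)) (divℕ c (suc e)) ⟩
    toℚᵘ (divℕ a (suc b)) ℚᵘ.+ toℚᵘ (divℕ c (suc e))     ≈⟨ ℚᵘ.+-cong (toℚᵘ-divℕ a b) (toℚᵘ-divℕ c e) ⟩
    mkℚᵘ (+ a) b ℚᵘ.+ mkℚᵘ (+ c) e                       ≈⟨ ℚᵘ.≃-reflexive (cong (λ z → mkℚᵘ z _) numerator≡) ⟩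
    mkℚᵘ (+ (a ℕ.* suc e ℕ.+ c ℕ.* suc b)) (ℕ.pred (suc b ℕ.* suc e)) ≈⟨ toℚᵘ-divℕ _ _ ⟨
    toℚᵘ (divℕ (a ℕ.* suc e ℕ.+ c ℕ.* suc b) (suc b ℕ.* suc e)) ∎)
    where
    open import Relation.Binary.Reasoning.Setoid ℚᵘ.≃-setoid
    numerator≡ : + a ℤ.* + suc e ℤ.+ + c ℤ.* + suc b ≡ + (a ℕ.* suc e ℕ.+ c ℕ.* suc b)
    numerator≡ = trans (cong₂ ℤ._+_ (sym (ℤ.pos-* a (suc e))) (sym (ℤ.pos-* c (suc b))))
                       (sym (ℤ.pos-+ (a ℕ.* suc e) (c ℕ.* suc b)))

  divℕ-≤ : ∀ a b c e → a ℕ.* suc e ℕ.≤ c ℕ.* suc b → divℕ a (suc b) ≤ divℕ c (suc e)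
  divℕ-≤ a b c e le = toℚᵘ-cancel-≤ (ℚᵘ.≤-respʳ-≃ (ℚᵘ.≃-sym (toℚᵘ-divℕ c e)) (ℚᵘ.≤-respˡ-≃ (ℚᵘ.≃-sym (toℚᵘ-divℕ a b))
    (*≤* (subst₂ ℤ._≤_ (ℤ.pos-* a (suc e)) (ℤ.pos-* c (suc b)) (ℤ.+≤+ le)))))

  module _ where
    open +-*-Solver

    [x+y]-y≡x : ∀ x y → (x + y) - y ≡ x
    [x+y]-y≡x = solve 2 (λ x y → (x :+ y) :- y := x) refl

    -[x-y]≡y-x : ∀ x y → - (x - y) ≡ y - x
    -[x-y]≡y-x = solve 2 (λ x y → :- (x :- y) := y :- x) refl

  1-divℕ1≡divℕ : ∀ b → 1ℚ - divℕ 1 (suc b) ≡ divℕ b (suc b)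
  1-divℕ1≡divℕ b = trans (cong (_- divℕ 1 (suc b)) (sym sum≡1)) ([x+y]-y≡x (divℕ b (suc b)) (divℕ 1 (suc b)))
    where
    cross : ∀ b → (b ℕ.* suc b ℕ.+ 1 ℕ.* suc b) ℕ.* 1 ≡ 1 ℕ.* (suc b ℕ.* suc b)
    cross = solve-∀
    sum≡1 : divℕ b (suc b) + divℕ 1 (suc b) ≡ 1ℚ
    sum≡1 = trans (divℕ-+ b b 1 b) (divℕ-cong (b ℕ.* suc b ℕ.+ 1 ℕ.* suc b) (b ℕ.+ b ℕ.* suc b) 1 0 (cross b))

  ratio≡÷ : ∀ p q → (q>0 : Positive q) → ratio p q ≡ (p ÷ q) {{pos⇒nonZero q {{q>0}}}}
  ratio≡÷ p (mkℚ +[1+ _ ] _ _) _ = refl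

  ratio-divℕ : ∀ X Y Z W → 0 ℕ.< Y → 0 ℕ.< Z → 0 ℕ.< W → ratio (divℕ X Y) (divℕ Z W) ≡ divℕ (X ℕ.* W) (Y ℕ.* Z)
  ratio-divℕ X (suc y) (suc z) (suc w) _ _ _ = begin
    ratio p q       ≡⟨ ratio≡÷ p q q>0 ⟩
    p * 1/ q        ≡⟨ cong (_* 1/ q) tq≡p ⟨
    (t * q) * 1/ q  ≡⟨ *-assoc t q (1/ q) ⟩
    t * (q * 1/ q)  ≡⟨ cong (t *_) (*-inverseʳ q) ⟩
    t * 1ℚ          ≡⟨ *-identityʳ t ⟩
    t               ∎
    where
    open ≡-Reasoning
    p = divℕ X (suc y)
    q = divℕ (suc z) (suc w)
    t = divℕ (X ℕ.* suc w) (suc y ℕ.* suc z)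
    q>0 : Positive q
    q>0 = normalize-pos (suc z) (suc w)
    instance
      q≢0 : NonZero q
      q≢0 = pos⇒nonZero q {{q>0}}
    cross : ∀ X w z y → X ℕ.* suc w ℕ.* suc z ℕ.* suc y ≡ X ℕ.* (suc y ℕ.* suc z ℕ.* suc w)
    cross = solve-∀
    tq≡p : t * q ≡ p
    tq≡p = trans (divℕ-* (X ℕ.* suc w) (suc y ℕ.* suc z) (suc z) (suc w) ℕ.z<s ℕ.z<s)
                 (divℕ-cong (X ℕ.* suc w ℕ.* suc z) (w ℕ.+ (z ℕ.+ y ℕ.* suc z) ℕ.* suc w) X y (cross X w z y))

  ∣∣≤-intro : ∀ {x q} → x ≤ q → - x ≤ q → ∣ x ∣ ≤ q
  ∣∣≤-intro {x} x≤q -x≤q with ∣p∣≡p∨∣p∣≡-p x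
  ... | inj₁ ∣x∣≡x  = subst (_≤ _) (sym ∣x∣≡x) x≤q
  ... | inj₂ ∣x∣≡-x = subst (_≤ _) (sym ∣x∣≡-x) -x≤q

  *-≤-+ : ∀ d P Q → d ℕ.* Q ℕ.≤ suc d ℕ.* P → d ℕ.* Q ℕ.≤ Q ℕ.+ d ℕ.* P
  *-≤-+ d P Q dQ≤[d+1]P with P ℕ.≤? Q
  ... | yes P≤Q = ℕ.≤-trans dQ≤[d+1]P (ℕ.+-monoˡ-≤ (d ℕ.* P) P≤Q)
  ... | no  P≰Q = ℕ.≤-trans (ℕ.*-monoʳ-≤ d (ℕ.<⇒≤ (ℕ.≰⇒> P≰Q))) (ℕ.m≤n+m (d ℕ.* P) Q)

  ∣divℕ-1∣≤ : ∀ P Q d → 0 ℕ.< Q → P ≈[ suc d ] Q → ∣ divℕ P Q - 1ℚ ∣ ≤ divℕ 1 (suc d)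
  ∣divℕ-1∣≤ P (suc Q) d _ (mk≲ P≲Q , mk≲ Q≲P) = ∣∣≤-intro
    (subst (p - 1ℚ ≤_) ([x+y]-y≡x q 1ℚ) (+-monoˡ-≤ (- 1ℚ) p≤q+1))
    (subst₂ _≤_ (sym (-[x-y]≡y-x p 1ℚ)) ([x+y]-y≡x q p) (+-monoˡ-≤ (- p) 1≤q+p))
    where
    p = divℕ P (suc Q)
    q = divℕ 1 (suc d)
    upper-cross : ∀ d P Q → P ℕ.* suc (d ℕ.* 1) ≡ suc d ℕ.* P
    upper-cross = solve-∀
    upper-cross′ : ∀ d Q → suc (suc d) ℕ.* Q ≡ (1 ℕ.* 1 ℕ.+ 1 ℕ.* suc d) ℕ.* Q
    upper-cross′ = solve-∀
    p≤q+1 : p ≤ q + 1ℚ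
    p≤q+1 = subst (p ≤_) (sym (divℕ-+ 1 d 1 0))
      (divℕ-≤ P Q (1 ℕ.* 1 ℕ.+ 1 ℕ.* suc d) (ℕ.pred (suc d ℕ.* 1)) (subst₂ ℕ._≤_ (sym (upper-cross d P Q)) (upper-cross′ d (suc Q)) P≲Q))
    lower-cross : ∀ d Q → suc d ℕ.* suc Q ≡ 1 ℕ.* (suc d ℕ.* suc Q)
    lower-cross = solve-∀
    lower-cross′ : ∀ d P Q → suc Q ℕ.+ suc d ℕ.* P ≡ (1 ℕ.* suc Q ℕ.+ P ℕ.* suc d) ℕ.* 1
    lower-cross′ = solve-∀
    1≤q+p : 1ℚ ≤ q + p
    1≤q+p = subst (1ℚ ≤_) (sym (divℕ-+ 1 d P Q))
      (divℕ-≤ 1 0 (1 ℕ.* suc Q ℕ.+ P ℕ.* suc d) (ℕ.pred (suc d ℕ.* suc Q)) (subst₂ ℕ._≤_ (lower-cross d Q) (lower-cross′ d P Q) (*-≤-+ (suc d) P (suc Q) Q≲P)))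

  divℕ1-↧≤ : ∀ ε → Positive ε → divℕ 1 (↧ₙ ε) ≤ ε
  divℕ1-↧≤ ε@(mkℚ +[1+ p ] d _) _ = subst (divℕ 1 (suc d) ≤_) (↥p/↧p≡p ε)
    (divℕ-≤ 1 d (suc p) d (ℕ.*-monoˡ-≤ (suc d) {1} {suc p} (s≤s z≤n)))

  trues falses : List Bool → ℕ
  trues []           = 0
  trues (true ∷ bs)  = suc (trues bs)
  trues (false ∷ bs) = trues bs
  falses []           = 0
  falses (true ∷ bs)  = falses bs
  falses (false ∷ bs) = suc (falses bs)

  trues+falses≡length : ∀ bs → trues bs ℕ.+ falses bs ≡ length bs
  trues+falses≡length []           = refl
  trues+falses≡length (true ∷ bs)  = cong suc (trues+falses≡length bs)
  trues+falses≡length (false ∷ bs) = trans (ℕ.+-suc (trues bs) (falses bs)) (cong suc (trues+falses≡length bs))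

  sum-indicator≡trues : ∀ bs → sum (map (λ c → if c then 1 else 0) bs) ≡ trues bs
  sum-indicator≡trues []           = refl
  sum-indicator≡trues (true ∷ bs)  = cong suc (sum-indicator≡trues bs)
  sum-indicator≡trues (false ∷ bs) = sum-indicator≡trues bs

  bernoulli-weight : ℚ → Bool → ℚ
  bernoulli-weight p c = if c then p else 1ℚ - p

  ∏-bernoulli-weight : ∀ b bs → foldr _*_ 1ℚ (map (bernoulli-weight (divℕ 1 (suc b))) bs)
                                  ≡ divℕ (b ^ falses bs) (suc b ^ length bs)
  ∏-bernoulli-weight b []           = refl
  ∏-bernoulli-weight b (true ∷ bs)  = trans (cong (divℕ 1 (suc b) *_) (∏-bernoulli-weight b bs))
    (trans (divℕ-* 1 (suc b) (b ^ falses bs) (suc b ^ length bs) ℕ.z<s (ℕ.m^n>0 (suc b) (length bs)))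
           (cong (λ t → divℕ t (suc b ^ suc (length bs))) (ℕ.*-identityˡ (b ^ falses bs))))
  ∏-bernoulli-weight b (false ∷ bs) = trans (cong₂ _*_ (1-divℕ1≡divℕ b) (∏-bernoulli-weight b bs))
    (divℕ-* b (suc b) (b ^ falses bs) (suc b ^ length bs) ℕ.z<s (ℕ.m^n>0 (suc b) (length bs)))

  entries : ∀ {N} → Mat N → List Bool
  entries {N} M = concatMap (λ i → map (M i) (allFin N)) (allFin N)

  length-concatMap-const : ∀ {A B : Set} k (f : A → List B) → (∀ x → length (f x) ≡ k) →
                           ∀ xs → length (concatMap f xs) ≡ length xs ℕ.* k
  length-concatMap-const k f len[f] []       = refl
  length-concatMap-const k f len[f] (x ∷ xs) =
    trans (List.length-++ (f x)) (cong₂ ℕ._+_ (len[f] x) (length-concatMap-const k f len[f] xs))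

  length-entries : ∀ {N} (M : Mat N) → length (entries M) ≡ N ℕ.* N
  length-entries {N} M = trans
    (length-concatMap-const N _ (λ i → trans (List.length-map (M i) (allFin N)) length-allFin) (allFin N))
    (cong (ℕ._* N) length-allFin)
    where
    length-allFin : length (allFin N) ≡ N
    length-allFin = List.length-tabulate {n = N} id

  ones≡trues : ∀ {N} (M : Mat N) → ones M ≡ trues (entries M)
  ones≡trues {N} M = trans (cong sum (sym (trans (List.map-concatMap _ (λ i → map (M i) (allFin N)) (allFin N))
                                                (List.concatMap-cong (λ i → sym (List.map-∘ (allFin N))) (allFin N)))))
                           (sum-indicator≡trues (entries M))

  probBern≡divℕ : ∀ b N (M : Mat N) → probBern (divℕ 1 (suc b)) N M ≡ divℕ (b ^ (N ℕ.* N ∸ ones M)) (suc b ^ (N ℕ.* N))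
  probBern≡divℕ b N M = begin
    probBern (divℕ 1 (suc b)) N M                                   ≡⟨ cong (foldr _*_ 1ℚ) weights≡ ⟩
    foldr _*_ 1ℚ (map (bernoulli-weight (divℕ 1 (suc b))) (entries M)) ≡⟨ ∏-bernoulli-weight b (entries M) ⟩
    divℕ (b ^ falses (entries M)) (suc b ^ length (entries M))     ≡⟨ cong₂ (λ e f → divℕ (b ^ e) (suc b ^ f)) falses≡ (length-entries M) ⟩
    divℕ (b ^ (N ℕ.* N ∸ ones M)) (suc b ^ (N ℕ.* N))               ∎
    where
    open ≡-Reasoning
    weights≡ : concatMap (λ i → map (λ j → if M i j then divℕ 1 (suc b) else (1ℚ - divℕ 1 (suc b))) (allFin N)) (allFin N)
               ≡ map (bernoulli-weight (divℕ 1 (suc b))) (entries M)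
    weights≡ = sym (trans (List.map-concatMap _ (λ i → map (M i) (allFin N)) (allFin N))
                          (List.concatMap-cong (λ i → sym (List.map-∘ (allFin N))) (allFin N)))
    falses≡ : falses (entries M) ≡ N ℕ.* N ∸ ones M
    falses≡ = trans (sym (ℕ.m+n∸m≡n (trues (entries M)) _))
                    (cong₂ _∸_ (trans (trues+falses≡length (entries M)) (length-entries M)) (sym (ones≡trues M)))

  ∣ratio-1∣≤ : ∀ b N d (M : Mat N) → 0 ℕ.< N → N ℕ.≤ suc b → N ^ 12 ℕ.≤ suc b ^ 7 →
    (∀ i j j′ → M i j ≡ true → M i j′ ≡ true → j ≡ j′) → (∀ i i′ j → M i j ≡ true → M i′ j ≡ true → i ≡ i′) →
    ones M ^ 5 ℕ.≤ suc b → (4 ℕ.* suc (suc d)) ^ 5 ℕ.≤ suc b →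
    ∣ ratio (probPerm (suc b) N M) (probBern (divℕ 1 (suc b)) N M) - 1ℚ ∣ ≤ divℕ 1 (suc d)
  ∣ratio-1∣≤ b N@(suc N′) d M _ N≤n N¹²≤n⁷ row≤1 col≤1 k⁵≤n c⁵≤n =
    subst (λ t → ∣ t - 1ℚ ∣ ≤ divℕ 1 (suc d)) (sym ratio≡) (∣divℕ-1∣≤ (X ℕ.* W) (n ↓ n ℕ.* Z) d YZ>0 XW≈YZ)
    where
    open Pattern b N N≤n M row≤1 col≤1 using (#empty-rows; length-matching; ones+#empty-rows≡N)
    n = suc b
    k = ones M
    m = #empty-rows
    [n∸N]! = (n ∸ N) ↓ (n ∸ N)
    X = (n ∸ N) ↓ m ℕ.* [n∸N]!
    W = n ^ (N ℕ.* N)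
    Z = b ^ (N ℕ.* N ∸ k)
    R : Regime n N k (suc d)
    R = regime n N k (suc d) N¹²≤n⁷ k⁵≤n c⁵≤n
    instance
      b≢0 : ℕ.NonZero b
      b≢0 = ℕ.>-nonZero (ℕ.s≤s⁻¹ (ℕ.≤-trans (s≤s (s≤s z≤n)) (ℕ.≤-trans (ℕ.m≤m*n 4 N) (Regime.4N≤n R))))
    Z>0 = ℕ.m^n>0 b (N ℕ.* N ∸ k)
    YZ>0 = ℕ.*-mono-≤ {1} {n ↓ n} (↓-positive n n ℕ.≤-refl) Z>0
    n↓n≡ : n ↓ n ≡ n ↓ N ℕ.* [n∸N]!
    n↓n≡ = trans (cong (n ↓_) (sym (ℕ.m+[n∸m]≡n N≤n))) (↓-split n N (n ∸ N))
    ratio≡ : ratio (probPerm n N M) (probBern (divℕ 1 n) N M) ≡ divℕ (X ℕ.* W) (n ↓ n ℕ.* Z)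
    ratio≡ = trans (cong₂ ratio (cong₂ divℕ length-matching (Counting.length-Sn n N N≤n)) (probBern≡divℕ b N M))
                   (ratio-divℕ X (n ↓ n) Z W (↓-positive n n ℕ.≤-refl) Z>0 (ℕ.m^n>0 n (N ℕ.* N)))
    XW≈YZ : X ℕ.* W ≈[ suc d ] n ↓ n ℕ.* Z
    XW≈YZ = subst₂ _≈[ suc d ]_ (xy∙z≈xz∙y ((n ∸ N) ↓ m) W [n∸N]!) (trans (xy∙z≈xz∙y (n ↓ N) Z [n∸N]!) (cong (ℕ._* Z) (sym n↓n≡)))
      (≈-*ʳ [n∸N]! (permutation≈bernoulli b N′ k m (suc d) N≡m+k R))
      where
      N≡m+k : N ≡ m ℕ.+ k
      N≡m+k = trans (sym ones+#empty-rows≡N) (ℕ.+-comm k m)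

open import Data.Nat as ℕ using (ℕ; zero; suc; _^_; _≥_)
open import Data.Rational as ℚ using (ℚ; Positive; _≤_; _-_; ∣_∣; 1ℚ; ↧ₙ_)
open import Data.Rational.Properties using (≤-trans)
open import Data.Product using (∃-syntax; _,_)

lemma3p2 : (ε : ℚ) → Positive ε →
    ∃[ n₀ ] ∀ (n : ℕ) → n ≥ n₀ → ∀ (M : Mat (floorN n)) → InM n M →
      ∣ ratio (probPerm n (floorN n) M) (probBern (divℕ 1 n) (floorN n) M) - 1ℚ ∣ ≤ ε
lemma3p2 ε ε>0 = (4 ℕ.* suc (↧ₙ ε)) ^ 5 , λ where
  zero    ()
  (suc b) n₀≤n M M∈𝓜 → ≤-trans
    (∣ratio-1∣≤ b (floorN (suc b)) (ℚ.denominator-1 ε) M (floorN>0 (suc b)) (floorN≤n (suc b)) (floorN^12≤n^7 (suc b))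
                 (InM.rowAtMostOne M∈𝓜) (InM.colAtMostOne M∈𝓜) (InM.sumBound M∈𝓜) n₀≤n)
    (divℕ1-↧≤ ε ε>0)
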